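{- Let $p,q$ be positive integers, and let $\{n_\alpha\}_{1\le \alpha\le p}$ and $\{m_\beta\}_{1\le \beta\le q}$ be sequences of positive integers. Set $n=\sum_{\alpha=1}^p n_\alpha$ and $m=\sum_{\beta=1}^q m_\beta$. Then there exists a degeneration between direct sums of matrix multiplication tensors: \[ \langle n,1,m\rangle \oplus \bigoplus_{\substack{1\le \alpha\le p\\1\le \beta\le q}} \langle 1,(n_\alpha-1)(m_\beta-1),1\rangle \ \trianglelefteq\ \langle nm\rangle \oplus \langle p,1,q\rangle. \]
   Context: $\langle n,m,p\rangle = \sum_{i,j,k} x_{ij}y_{jk}z_{ki}$ is the matrix multiplication tensor, $\langle r\rangle$ the diagonal tensor of size $r$, $\trianglelefteq$ degeneration, $\oplus$ direct sum. -}

module Defs where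

open import Level using (Level; _⊔_)
open import Data.Nat as ℕ using (ℕ; zero; suc; _∸_; _≤_)
open import Data.Fin as Fin using (Fin; splitAt; remQuot)
open import Data.Fin.Properties using (_≟_)
open import Data.Product using (Σ; _×_; _,_; proj₁; proj₂; ∃)
open import Data.Sum using (inj₁; inj₂)
open import Data.Bool using (Bool; true; false; _∧_; if_then_else_)
open import Relation.Nullary using (¬_)
open import Relation.Nullary.Decidable using (⌊_⌋)
open import Algebra.Bundles using (CommutativeRing)

record Field (c ℓ : Level) : Set (Level.suc (c ⊔ ℓ)) where
  field
    commutativeRing : CommutativeRing c ℓ
  open CommutativeRing commutativeRing public
  field
    1≉0     : ¬ (1# ≈ 0#)
    inverse : ∀ x → ¬ (x ≈ 0#) → Σ Carrier (λ y → (x * y) ≈ 1#)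

sumℕ : (p : ℕ) → (Fin p → ℕ) → ℕ
sumℕ zero    f = 0
sumℕ (suc p) f = f Fin.zero ℕ.+ sumℕ p (λ i → f (Fin.suc i))

module _ {c ℓ : Level} (K : Field c ℓ) where
  open Field K

  Σ[<_] : (n : ℕ) → (Fin n → Carrier) → Carrier
  Σ[< zero  ] f = 0#
  Σ[< suc n ] f = f Fin.zero + Σ[< n ] (λ i → f (Fin.suc i))

  Σ[0…_] : (d : ℕ) → (ℕ → Carrier) → Carrier
  Σ[0… zero  ] f = f 0
  Σ[0… suc d ] f = Σ[0… d ] f + f (suc d)

  record Tensor : Set c where
    constructor mkT
    field
      da db dc : ℕ
      entry    : Fin da → Fin db → Fin dc → Carrier
  open Tensor public

  δ : Bool → Carrier
  δ true  = 1#
  δ false = 0#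

  unitT : ℕ → Tensor
  unitT r = mkT r r r (λ i j k → δ (⌊ i ≟ j ⌋ ∧ ⌊ j ≟ k ⌋))

  -- matrix multiplication tensor ⟨n,m,p⟩ = Σ_{i,j,k} x_{ij} ⊗ y_{jk} ⊗ z_{ki}
  -- in K^{n m} ⊗ K^{m p} ⊗ K^{p n}; x_{ij} is basis vector combine i j.
  MaMu : ℕ → ℕ → ℕ → Tensor
  MaMu n m p = mkT (n ℕ.* m) (m ℕ.* p) (p ℕ.* n) ent
    where
    ent : Fin (n ℕ.* m) → Fin (m ℕ.* p) → Fin (p ℕ.* n) → Carrier
    ent u v w with remQuot {n} m u | remQuot {m} p v | remQuot {p} n w
    ... | (i , j) | (j′ , k) | (k′ , i′) =
      δ (⌊ i ≟ i′ ⌋ ∧ ⌊ j ≟ j′ ⌋ ∧ ⌊ k ≟ k′ ⌋)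

  _⊕_ : Tensor → Tensor → Tensor
  T ⊕ S = mkT (da T ℕ.+ da S) (db T ℕ.+ db S) (dc T ℕ.+ dc S) ent
    where
    ent : _ → _ → _ → Carrier
    ent u v w with splitAt (da T) u | splitAt (db T) v | splitAt (dc T) w
    ... | inj₁ i | inj₁ j | inj₁ k = entry T i j k
    ... | inj₂ i | inj₂ j | inj₂ k = entry S i j k
    ... | _      | _      | _      = 0#

  zeroT : Tensor
  zeroT = mkT 0 0 0 (λ ())

  ⨁ : (r : ℕ) → (Fin r → Tensor) → Tensor
  ⨁ zero    T = zeroT
  ⨁ (suc r) T = T Fin.zero ⊕ ⨁ r (λ i → T (Fin.suc i))

  Mat : ℕ → ℕ → Set c
  Mat a′ a = Fin a′ → Fin a → Carrier

  act : (S : Tensor) {a′ b′ c′ : ℕ} →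
        Mat a′ (da S) → Mat b′ (db S) → Mat c′ (dc S) →
        Fin a′ → Fin b′ → Fin c′ → Carrier
  act S A B C u′ v′ w′ =
    Σ[< da S ] λ u → Σ[< db S ] λ v → Σ[< dc S ] λ w →
      A u′ u * (B v′ v * (C w′ w * entry S u v w))

  -- Degeneration (Bürgisser–Clausen–Shokrollahi, §15.4): T ⊴ S iff there are
  -- e ∈ ℕ and matrices A(ε) = Σ_i A i εⁱ, B(ε), C(ε) with polynomial entries in ε
  -- such that (A(ε) ⊗ B(ε) ⊗ C(ε)) S = ε^e T + O(ε^{e+1}).
  -- The ε^d-coefficient only involves A i, B j, C k with i + j + k = d, so
  -- the matrices are given as sequences (coefficients of degree > e are
  -- irrelevant and may be taken to be zero).
  coeff : (S : Tensor) {a′ b′ c′ : ℕ} →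
          (ℕ → Mat a′ (da S)) → (ℕ → Mat b′ (db S)) → (ℕ → Mat c′ (dc S)) →
          ℕ → Fin a′ → Fin b′ → Fin c′ → Carrier
  coeff S A B C d u′ v′ w′ =
    Σ[0… d ] λ i → Σ[0… d ∸ i ] λ j →
      act S (A i) (B j) (C (d ∸ i ∸ j)) u′ v′ w′

  _⊴_ : Tensor → Tensor → Set (c ⊔ ℓ)
  T ⊴ S = Σ ℕ λ e →
    Σ (ℕ → Mat (da T) (da S)) λ A →
    Σ (ℕ → Mat (db T) (db S)) λ B →
    Σ (ℕ → Mat (dc T) (dc S)) λ C →
      (∀ d → d ℕ.< e → ∀ u v w → coeff S A B C d u v w ≈ 0#) ×
      (∀ u v w → coeff S A B C e u v w ≈ entry T u v w)

{-# OPTIONS --safe #-}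
-- Index ⟨nm⟩ = Σ e_ij ⊗ e_ij ⊗ e_ij by pairs (i, j), with i at offset a in block α of n = Σ nα and j at
-- offset b in block β of m = Σ mβ. The three matrices send e_ij to
--   x_i + ε U_ij,    y_j + ε V_ij,    z_αβ + ε² z_ji,
-- and the basis vectors x_α, y_β, z_βα of ⟨p,1,q⟩ to Σ_{i∈α} x_i, Σ_{j∈β} y_j and − z_αβ, where z_αβ spans
-- the third factor of the summand ⟨1,(nα−1)(mβ−1),1⟩; so the ε⁰ terms cancel. With t = (t₁, t₂) indexing
-- that summand and e_last the last basis vector,
--   U_ij = Σ_t [b = t₂] (e_t₁ − e_last)(a) x_αβt,    V_ij = Σ_t [a = t₁] (e_t₂ − e_last)(b) y_αβt.
-- The coordinates of e_c − e_last sum to 0, so the ε¹ terms vanish within each block; and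
-- ⟨e_c − e_last, e_c′⟩ = [c = c′] for c′ ≠ last, so Σ U_ij ⊗ V_ij ⊗ z_αβ = ⨁ ⟨1,(nα−1)(mβ−1),1⟩, while the
-- other ε² term Σ x_i ⊗ y_j ⊗ z_ji is ⟨n,1,m⟩.
module Submission where

open import Defs
open import Level using (Level; _⊔_)
open import Data.Nat as ℕ using (ℕ; zero; suc; _∸_; _≤_; _<_)
import Data.Nat.Properties as ℕ
open import Data.Fin as Fin using (Fin; zero; suc; toℕ; fromℕ<; splitAt; remQuot; combine; _↑ˡ_; _↑ʳ_)
import Data.Fin.Properties as Fin
open import Data.Fin.Properties using (_≟_)
open import Data.Product using (Σ; _×_; _,_; proj₁; proj₂; uncurry)
import Data.Product as Product
open import Data.Sum using (_⊎_; inj₁; inj₂; [_,_]′)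
import Data.Sum as Sum
open import Data.Unit using (⊤; tt)
open import Data.Bool using (true; false; _∧_)
open import Data.Empty using (⊥-elim)
open import Function using (_∘_; id; flip)
open import Data.Vec.Functional using (_++_)
open import Data.Vec.Functional.Properties using (lookup-++ˡ; lookup-++ʳ)
open import Relation.Nullary using (¬_; Dec; yes; no; _×-dec_)
open import Relation.Nullary.Decidable using (⌊_⌋)
open import Relation.Binary.PropositionalEquality as ≡ using (_≡_; _≢_)

splitBlock : ∀ {p} (g : Fin p → ℕ) → Fin (sumℕ p g) → Σ (Fin p) (Fin ∘ g)
splitBlock {suc p} g i = [ (zero ,_) , Product.map suc id ∘ splitBlock (g ∘ suc) ]′ (splitAt (g zero) i)

joinBlock : ∀ {p} (g : Fin p → ℕ) (α : Fin p) → Fin (g α) → Fin (sumℕ p g)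
joinBlock g zero    l = l ↑ˡ _
joinBlock g (suc α) l = g zero ↑ʳ joinBlock (g ∘ suc) α l

splitBlock-joinBlock : ∀ {p} (g : Fin p → ℕ) α l → splitBlock g (joinBlock g α l) ≡ (α , l)
splitBlock-joinBlock {suc p} g zero l = ≡.cong [ _ , _ ]′ (Fin.splitAt-↑ˡ (g zero) l _)
splitBlock-joinBlock {suc p} g (suc α) l = begin
  splitBlock g (joinBlock g (suc α) l)
    ≡⟨ ≡.cong [ _ , _ ]′ (Fin.splitAt-↑ʳ (g zero) _ _) ⟩
  Product.map suc id (splitBlock (g ∘ suc) (joinBlock (g ∘ suc) α l))
    ≡⟨ ≡.cong (Product.map suc id) (splitBlock-joinBlock (g ∘ suc) α l) ⟩
  (suc α , l) ∎
  where open ≡.≡-Reasoning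

Fin1-irrelevant : (o o′ : Fin 1) → o ≡ o′
Fin1-irrelevant zero zero = ≡.refl

block : ∀ {p} (g : Fin p → ℕ) → Fin (sumℕ p g) → Fin p
block g = proj₁ ∘ splitBlock g

offset : ∀ {p} (g : Fin p → ℕ) → Fin (sumℕ p g) → ℕ
offset g = toℕ ∘ proj₂ ∘ splitBlock g

block-joinBlock : ∀ {p} (g : Fin p → ℕ) α l → block g (joinBlock g α l) ≡ α
block-joinBlock g α l = ≡.cong proj₁ (splitBlock-joinBlock g α l)

offset-joinBlock : ∀ {p} (g : Fin p → ℕ) α l → offset g (joinBlock g α l) ≡ toℕ l
offset-joinBlock g α l = ≡.cong (toℕ ∘ proj₂) (splitBlock-joinBlock g α l)

module _ {c ℓ : Level} (K : Field c ℓ) where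
  open Field K hiding (zero)
  open import Algebra.Properties.Semiring.Sum semiring
  open import Algebra.Properties.Ring ring using (-0#≈0#; -‿+-comm)
  open import Algebra.Properties.CommutativeSemigroup *-commutativeSemigroup using (x∙yz≈y∙xz)
  open import Algebra.Solver.CommutativeMonoid *-commutativeMonoid using (solve; _⊜_) renaming (_⊕_ to _·_)
  open import Relation.Binary.Reasoning.Setoid setoid

  Σ[<]≈∑ : ∀ n {f g : Fin n → Carrier} → (∀ i → f i ≈ g i) → Σ[<_] K n f ≈ ∑[ i < n ] g i
  Σ[<]≈∑ zero    f≈g = refl
  Σ[<]≈∑ (suc n) f≈g = +-cong (f≈g zero) (Σ[<]≈∑ n (f≈g ∘ suc))

  ∑-zero : ∀ {n} {f : Fin n → Carrier} → (∀ i → f i ≈ 0#) → ∑[ i < n ] f i ≈ 0#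
  ∑-zero {n} f≈0 = trans (sum-cong-≋ f≈0) (sum-replicate-zero n)

  ∑-*ˡ : ∀ {n} a (f : Fin n → Carrier) → ∑[ i < n ] (a * f i) ≈ a * ∑[ i < n ] f i
  ∑-*ˡ a f = sym (*-distribˡ-sum a f)

  ∑-neg : ∀ {n} (f : Fin n → Carrier) → ∑[ i < n ] (- f i) ≈ - ∑[ i < n ] f i
  ∑-neg {zero}  f = sym -0#≈0#
  ∑-neg {suc n} f = trans (+-congˡ (∑-neg (f ∘ suc))) (-‿+-comm _ _)

  ∑-*-∑ : ∀ {m n} (f : Fin m → Carrier) (g : Fin n → Carrier) →
          ∑[ i < m ] ∑[ j < n ] (f i * g j) ≈ ∑[ i < m ] f i * ∑[ j < n ] g j
  ∑-*-∑ f g = trans (sum-cong-≋ λ i → ∑-*ˡ (f i) g) (sym (*-distribʳ-sum _ f))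

  ∑-sift : ∀ {n} (f : Fin n → Carrier) i₀ → (∀ i → i ≢ i₀ → f i ≈ 0#) → ∑[ i < n ] f i ≈ f i₀
  ∑-sift {suc n} f zero     f≈0 = trans (+-congˡ (∑-zero λ i → f≈0 (suc i) λ ())) (+-identityʳ _)
  ∑-sift {suc n} f (suc i₀) f≈0 =
    trans (+-cong (f≈0 zero λ ()) (∑-sift (f ∘ suc) i₀ λ i i≢i₀ → f≈0 (suc i) (i≢i₀ ∘ Fin.suc-injective)))
          (+-identityˡ _)

  ∑-↑ : ∀ a {b} (f : Fin (a ℕ.+ b) → Carrier) →
        ∑[ i < a ℕ.+ b ] f i ≈ ∑[ i < a ] f (i ↑ˡ b) + ∑[ j < b ] f (a ↑ʳ j)
  ∑-↑ zero    f = sym (+-identityˡ _)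
  ∑-↑ (suc a) f = trans (+-congˡ (∑-↑ a (f ∘ suc))) (sym (+-assoc _ _ _))

  ∑-↑-vanishingʳ : ∀ a {b} (f : Fin (a ℕ.+ b) → Carrier) → (∀ j → f (a ↑ʳ j) ≈ 0#) →
                   ∑[ i < a ℕ.+ b ] f i ≈ ∑[ i < a ] f (i ↑ˡ b)
  ∑-↑-vanishingʳ a f f≈0 = trans (∑-↑ a f) (trans (+-congˡ (∑-zero f≈0)) (+-identityʳ _))

  ∑-↑-vanishingˡ : ∀ a {b} (f : Fin (a ℕ.+ b) → Carrier) → (∀ i → f (i ↑ˡ b) ≈ 0#) →
                   ∑[ i < a ℕ.+ b ] f i ≈ ∑[ j < b ] f (a ↑ʳ j)
  ∑-↑-vanishingˡ a f f≈0 = trans (∑-↑ a f) (trans (+-congʳ (∑-zero f≈0)) (+-identityˡ _))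

  ∑-combine : ∀ a {b} (f : Fin (a ℕ.* b) → Carrier) →
              ∑[ k < a ℕ.* b ] f k ≈ ∑[ i < a ] ∑[ j < b ] f (combine i j)
  ∑-combine zero    f = refl
  ∑-combine (suc a) {b} f = trans (∑-↑ b f) (+-congˡ (∑-combine a (f ∘ (b ↑ʳ_))))

  ∑-blocks : ∀ {p} (g : Fin p → ℕ) (f : Fin (sumℕ p g) → Carrier) →
             ∑[ i < sumℕ p g ] f i ≈ ∑[ α < p ] ∑[ l < g α ] f (joinBlock g α l)
  ∑-blocks {zero}  g f = refl
  ∑-blocks {suc p} g f = trans (∑-↑ (g zero) f) (+-congˡ (∑-blocks (g ∘ suc) _))

  +-≈0 : ∀ {x y} → x ≈ 0# → y ≈ 0# → x + y ≈ 0#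
  +-≈0 x≈0 y≈0 = trans (+-cong x≈0 y≈0) (+-identityʳ 0#)

  *-zero₃ : ∀ x y {z} → z ≈ 0# → x * (y * z) ≈ 0#
  *-zero₃ x y {z} z≈0 = begin
    x * (y * z)  ≈⟨ *-congˡ (*-congˡ z≈0) ⟩
    x * (y * 0#) ≈⟨ *-congˡ (zeroʳ y) ⟩
    x * 0#       ≈⟨ zeroʳ x ⟩
    0#           ∎

  𝟙[_] : ∀ {a} {P : Set a} → Dec P → Carrier
  𝟙[ P? ] = δ K ⌊ P? ⌋

  δ-∧ : ∀ x y → δ K (x ∧ y) ≈ δ K x * δ K y
  δ-∧ true  y = sym (*-identityˡ _)
  δ-∧ false y = sym (zeroˡ _)

  𝟙-yes : ∀ {a} {P : Set a} (P? : Dec P) → P → 𝟙[ P? ] ≈ 1#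
  𝟙-yes (yes _) _ = refl
  𝟙-yes (no ¬p) p = ⊥-elim (¬p p)

  𝟙-no : ∀ {a} {P : Set a} (P? : Dec P) → ¬ P → 𝟙[ P? ] ≈ 0#
  𝟙-no (yes p) ¬p = ⊥-elim (¬p p)
  𝟙-no (no _)  _  = refl

  𝟙-cong : ∀ {a b} {P : Set a} {Q : Set b} (P? : Dec P) (Q? : Dec Q) → (P → Q) → (Q → P) → 𝟙[ P? ] ≈ 𝟙[ Q? ]
  𝟙-cong (yes p) Q? P→Q Q→P = sym (𝟙-yes Q? (P→Q p))
  𝟙-cong (no ¬p) Q? P→Q Q→P = sym (𝟙-no Q? (¬p ∘ Q→P))

  𝟙-×-dec : ∀ {a b} {P : Set a} {Q : Set b} (P? : Dec P) (Q? : Dec Q) → 𝟙[ P? ×-dec Q? ] ≈ 𝟙[ P? ] * 𝟙[ Q? ]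
  𝟙-×-dec (yes p) Q? = trans (𝟙-cong (yes p ×-dec Q?) Q? proj₂ (p ,_)) (sym (*-identityˡ 𝟙[ Q? ]))
  𝟙-×-dec (no ¬p) Q? = trans (𝟙-no (no ¬p ×-dec Q?) (¬p ∘ proj₁)) (sym (zeroˡ 𝟙[ Q? ]))

  δ-∧-𝟙 : ∀ {a b} {P : Set a} {Q : Set b} (P? : Dec P) (Q? : Dec Q) → δ K (⌊ P? ⌋ ∧ ⌊ Q? ⌋) ≈ 𝟙[ P? ×-dec Q? ]
  δ-∧-𝟙 P? Q? = trans (δ-∧ ⌊ P? ⌋ ⌊ Q? ⌋) (sym (𝟙-×-dec P? Q?))

  ∑-𝟙-unique : ∀ {n a} {P : Fin n → Set a} (P? : ∀ i → Dec (P i)) {i₀} → P i₀ → (∀ {i} → P i → i ≡ i₀) →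
               (f : Fin n → Carrier) → ∑[ i < n ] (𝟙[ P? i ] * f i) ≈ f i₀
  ∑-𝟙-unique P? {i₀} Pi₀ unique f = begin
    ∑[ i < _ ] (𝟙[ P? i ] * f i) ≈⟨ ∑-sift _ i₀ (λ i i≢i₀ → trans (*-congʳ (𝟙-no (P? i) (i≢i₀ ∘ unique))) (zeroˡ _)) ⟩
    𝟙[ P? i₀ ] * f i₀          ≈⟨ *-congʳ (𝟙-yes (P? i₀) Pi₀) ⟩
    1# * f i₀                  ≈⟨ *-identityˡ _ ⟩
    f i₀                       ∎

  ∑-𝟙-sift : ∀ {n} (i₀ : Fin n) (f : Fin n → Carrier) → ∑[ i < n ] (𝟙[ i ≟ i₀ ] * f i) ≈ f i₀
  ∑-𝟙-sift i₀ = ∑-𝟙-unique (_≟ i₀) ≡.refl id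

  ∑-𝟙-block : ∀ {p} (g : Fin p → ℕ) α (f : Fin (sumℕ p g) → Carrier) →
              ∑[ i < sumℕ p g ] (𝟙[ block g i ≟ α ] * f i) ≈ ∑[ l < g α ] f (joinBlock g α l)
  ∑-𝟙-block {p} g α f = begin
    ∑[ i < sumℕ p g ] (𝟙[ block g i ≟ α ] * f i)
      ≈⟨ ∑-blocks g _ ⟩
    ∑[ β < p ] ∑[ l < g β ] (𝟙[ block g (joinBlock g β l) ≟ α ] * f (joinBlock g β l))
      ≈⟨ sum-cong-≋ (λ β → sum-cong-≋ λ l → *-congʳ (reflexive (≡.cong (λ γ → 𝟙[ γ ≟ α ]) (block-joinBlock g β l)))) ⟩
    ∑[ β < p ] ∑[ l < g β ] (𝟙[ β ≟ α ] * f (joinBlock g β l))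
      ≈⟨ sum-cong-≋ (λ β → ∑-*ˡ 𝟙[ β ≟ α ] (f ∘ joinBlock g β)) ⟩
    ∑[ β < p ] (𝟙[ β ≟ α ] * ∑[ l < g β ] f (joinBlock g β l))
      ≈⟨ ∑-𝟙-sift α _ ⟩
    ∑[ l < g α ] f (joinBlock g α l) ∎

  ∑-𝟙-toℕ : ∀ {k c} → c < k → (f : ℕ → Carrier) → ∑[ l < k ] (𝟙[ toℕ l ℕ.≟ c ] * f (toℕ l)) ≈ f c
  ∑-𝟙-toℕ {k} {c} c<k f = trans (∑-𝟙-unique (λ l → toℕ l ℕ.≟ c) (Fin.toℕ-fromℕ< c<k) at-c (f ∘ toℕ))
                                 (reflexive (≡.cong f (Fin.toℕ-fromℕ< c<k)))
    where
    at-c : ∀ {l} → toℕ l ≡ c → l ≡ fromℕ< c<k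
    at-c l≡c = Fin.toℕ-injective (≡.trans l≡c (≡.sym (Fin.toℕ-fromℕ< c<k)))

  ∑-𝟙-toℕ-count : ∀ {k c} → c < k → ∑[ l < k ] 𝟙[ toℕ l ℕ.≟ c ] ≈ 1#
  ∑-𝟙-toℕ-count {k} {c} c<k = trans (sum-cong-≋ {k} λ l → sym (*-identityʳ 𝟙[ toℕ l ℕ.≟ c ])) (∑-𝟙-toℕ c<k (λ _ → 1#))

  diffLast : ℕ → ℕ → ℕ → Carrier
  diffLast k c a = 𝟙[ a ℕ.≟ c ] - 𝟙[ a ℕ.≟ k ∸ 1 ]

  diffLast-below : ∀ {k} c {a} → a < k ∸ 1 → diffLast k c a ≈ 𝟙[ a ℕ.≟ c ]
  diffLast-below {k} c {a} a<k-1 = begin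
    𝟙[ a ℕ.≟ c ] - 𝟙[ a ℕ.≟ k ∸ 1 ] ≈⟨ +-congˡ (-‿cong (𝟙-no (a ℕ.≟ k ∸ 1) (ℕ.<⇒≢ a<k-1))) ⟩
    𝟙[ a ℕ.≟ c ] - 0#               ≈⟨ +-congˡ -0#≈0# ⟩
    𝟙[ a ℕ.≟ c ] + 0#               ≈⟨ +-identityʳ _ ⟩
    𝟙[ a ℕ.≟ c ]                    ∎

  ∑-diffLast : ∀ {k c} → c < k ∸ 1 → ∑[ l < k ] diffLast k c (toℕ l) ≈ 0#
  ∑-diffLast {k} {c} c<k-1 = begin
    ∑[ l < k ] (𝟙[ toℕ l ℕ.≟ c ] - 𝟙[ toℕ l ℕ.≟ k ∸ 1 ])
      ≈⟨ ∑-distrib-+ {k} (λ l → 𝟙[ toℕ l ℕ.≟ c ]) (λ l → - 𝟙[ toℕ l ℕ.≟ k ∸ 1 ]) ⟩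
    ∑[ l < k ] 𝟙[ toℕ l ℕ.≟ c ] + ∑[ l < k ] (- 𝟙[ toℕ l ℕ.≟ k ∸ 1 ])
      ≈⟨ +-cong (∑-𝟙-toℕ-count c<k) (trans (∑-neg {k} (λ l → 𝟙[ toℕ l ℕ.≟ k ∸ 1 ])) (-‿cong (∑-𝟙-toℕ-count k-1<k))) ⟩
    1# - 1#
      ≈⟨ -‿inverseʳ 1# ⟩
    0# ∎
    where
    c<k : c < k
    c<k = ℕ.<-≤-trans c<k-1 (ℕ.m∸n≤m k 1)
    k-1<k : k ∸ 1 < k
    k-1<k = ℕ.∸-monoʳ-< {k} {1} {0} ℕ.z<s (ℕ.≤-trans (ℕ.s≤s ℕ.z≤n) c<k)

  ∑-𝟙-diffLast : ∀ {k c} c′ → c < k ∸ 1 → ∑[ l < k ] (𝟙[ toℕ l ℕ.≟ c ] * diffLast k c′ (toℕ l)) ≈ 𝟙[ c ℕ.≟ c′ ]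
  ∑-𝟙-diffLast {k} c′ c<k-1 = trans (∑-𝟙-toℕ (ℕ.<-≤-trans c<k-1 (ℕ.m∸n≤m k 1)) (diffLast k c′)) (diffLast-below {k} c′ c<k-1)

  ∑-𝟙-block-diffLast : ∀ {p} (g : Fin p → ℕ) α {c} → c < g α ∸ 1 → (h : Fin p → Carrier) →
                       ∑[ i < sumℕ p g ] (𝟙[ block g i ≟ α ] * (diffLast (g α) c (offset g i) * h (block g i))) ≈ 0#
  ∑-𝟙-block-diffLast g α {c} c<gα-1 h = begin
    ∑[ i < sumℕ _ g ] (𝟙[ block g i ≟ α ] * (diffLast (g α) c (offset g i) * h (block g i)))
      ≈⟨ ∑-𝟙-block g α _ ⟩
    ∑[ l < g α ] (diffLast (g α) c (offset g (joinBlock g α l)) * h (block g (joinBlock g α l)))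
      ≈⟨ sum-cong-≋ (λ l → reflexive (≡.cong₂ (λ a β → diffLast (g α) c a * h β) (offset-joinBlock g α l) (block-joinBlock g α l))) ⟩
    ∑[ l < g α ] (diffLast (g α) c (toℕ l) * h α)
      ≈⟨ *-distribʳ-sum {g α} (h α) (diffLast (g α) c ∘ toℕ) ⟨
    ∑[ l < g α ] diffLast (g α) c (toℕ l) * h α
      ≈⟨ *-congʳ (∑-diffLast {g α} c<gα-1) ⟩
    0# * h α
      ≈⟨ zeroˡ (h α) ⟩
    0# ∎

  ⟪_,_,_⟫ : ∀ {a b} → (f g h : Fin a → Fin b → Carrier) → Carrier
  ⟪_,_,_⟫ {a} {b} f g h = ∑[ i < a ] ∑[ j < b ] (f i j * (g i j * h i j))

  ⟪0,_,_⟫ : ∀ {a b} (g h : Fin a → Fin b → Carrier) → ⟪ (λ _ _ → 0#) , g , h ⟫ ≈ 0#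
  ⟪0,_,_⟫ {a} {b} g h = ∑-zero {a} λ i → ∑-zero {b} λ j → zeroˡ (g i j * h i j)

  ⟪_,0,_⟫ : ∀ {a b} (f h : Fin a → Fin b → Carrier) → ⟪ f , (λ _ _ → 0#) , h ⟫ ≈ 0#
  ⟪_,0,_⟫ {a} {b} f h = ∑-zero {a} λ i → ∑-zero {b} λ j → trans (*-congˡ (zeroˡ (h i j))) (zeroʳ (f i j))

  ⟪_,_,0⟫ : ∀ {a b} (f g : Fin a → Fin b → Carrier) → ⟪ f , g , (λ _ _ → 0#) ⟫ ≈ 0#
  ⟪_,_,0⟫ {a} {b} f g = ∑-zero {a} λ i → ∑-zero {b} λ j → *-zero₃ (f i j) (g i j) refl

  ⟪𝟙,_,_⟫ : ∀ {a b} (i₀ : Fin a) (g h : Fin a → Fin b → Carrier) →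
            ⟪ (λ i _ → 𝟙[ i ≟ i₀ ]) , g , h ⟫ ≈ ∑[ j < b ] (g i₀ j * h i₀ j)
  ⟪𝟙,_,_⟫ {b = b} i₀ g h = trans (sum-cong-≋ λ i → ∑-*ˡ 𝟙[ i ≟ i₀ ] λ j → g i j * h i j) (∑-𝟙-sift i₀ _)

  ⟪_,𝟙,_⟫ : ∀ {a b} (f : Fin a → Fin b → Carrier) (j₀ : Fin b) (h : Fin a → Fin b → Carrier) →
            ⟪ f , (λ _ j → 𝟙[ j ≟ j₀ ]) , h ⟫ ≈ ∑[ i < a ] (f i j₀ * h i j₀)
  ⟪_,𝟙,_⟫ f j₀ h = sum-cong-≋ λ i →
    trans (sum-cong-≋ λ j → x∙yz≈y∙xz (f i j) 𝟙[ j ≟ j₀ ] (h i j)) (∑-𝟙-sift j₀ λ j → f i j * h i j)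

  ⟪𝟙,𝟙,_⟫ : ∀ {a b} (i₀ : Fin a) (j₀ : Fin b) (h : Fin a → Fin b → Carrier) →
            ⟪ (λ i _ → 𝟙[ i ≟ i₀ ]) , (λ _ j → 𝟙[ j ≟ j₀ ]) , h ⟫ ≈ h i₀ j₀
  ⟪𝟙,𝟙,_⟫ i₀ j₀ h = trans (⟪𝟙,_,_⟫ i₀ _ h) (∑-𝟙-sift j₀ (h i₀))

  -- Presentations of tensors

  record Presentation (T : Tensor K) (X Y Z : Set) : Set (c ⊔ ℓ) where
    field
      decodeX     : Fin (da T) → X
      decodeY     : Fin (db T) → Y
      decodeZ     : Fin (dc T) → Z
      value       : X → Y → Z → Carrier
      entry≈value : ∀ u v w → entry T u v w ≈ value (decodeX u) (decodeY v) (decodeZ w)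
  open Presentation

  Presentation-map : ∀ {T X Y Z X′ Y′ Z′} (P : Presentation T X Y Z) (f : X → X′) (g : Y → Y′) (h : Z → Z′)
                     (value′ : X′ → Y′ → Z′ → Carrier) → (∀ x y z → value P x y z ≈ value′ (f x) (g y) (h z)) →
                     Presentation T X′ Y′ Z′
  Presentation-map P f g h value′ value≈ = record
    { decodeX = f ∘ decodeX P ; decodeY = g ∘ decodeY P ; decodeZ = h ∘ decodeZ P ; value = value′
    ; entry≈value = λ u v w → trans (entry≈value P u v w) (value≈ _ _ _) }

  MaMu-value : ∀ {a b c} → Fin a × Fin b → Fin b × Fin c → Fin c × Fin a → Carrier
  MaMu-value (i , j) (j′ , k) (k′ , i′) = 𝟙[ (i ≟ i′) ×-dec (j ≟ j′) ×-dec (k ≟ k′) ]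

  MaMu-presentation : ∀ a b c → Presentation (MaMu K a b c) (Fin a × Fin b) (Fin b × Fin c) (Fin c × Fin a)
  MaMu-presentation a b c = record
    { decodeX = remQuot b ; decodeY = remQuot c ; decodeZ = remQuot a ; value = MaMu-value
    ; entry≈value = λ u v w → entry≈𝟙 (remQuot b u) (remQuot c v) (remQuot a w) }
    where
    entry≈𝟙 : ∀ (x : Fin a × Fin b) (y : Fin b × Fin c) (z : Fin c × Fin a) →
              δ K (⌊ proj₁ x ≟ proj₂ z ⌋ ∧ ⌊ proj₂ x ≟ proj₁ y ⌋ ∧ ⌊ proj₂ y ≟ proj₁ z ⌋) ≈ MaMu-value x y z
    entry≈𝟙 (i , j) (j′ , k) (k′ , i′) = begin
      δ K (⌊ i ≟ i′ ⌋ ∧ ⌊ j ≟ j′ ⌋ ∧ ⌊ k ≟ k′ ⌋)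
        ≈⟨ δ-∧ ⌊ i ≟ i′ ⌋ (⌊ j ≟ j′ ⌋ ∧ ⌊ k ≟ k′ ⌋) ⟩
      𝟙[ i ≟ i′ ] * δ K (⌊ j ≟ j′ ⌋ ∧ ⌊ k ≟ k′ ⌋)
        ≈⟨ *-congˡ (δ-∧-𝟙 (j ≟ j′) (k ≟ k′)) ⟩
      𝟙[ i ≟ i′ ] * 𝟙[ (j ≟ j′) ×-dec (k ≟ k′) ]
        ≈⟨ 𝟙-×-dec (i ≟ i′) ((j ≟ j′) ×-dec (k ≟ k′)) ⟨
      MaMu-value (i , j) (j′ , k) (k′ , i′) ∎

  MaMu-value-combine : ∀ {a b c} (i i′ : Fin a) (j j′ : Fin b) (k k′ : Fin c) →
                       MaMu-value (remQuot b (combine i j)) (remQuot c (combine j′ k)) (remQuot a (combine k′ i′)) ≡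
                       MaMu-value (i , j) (j′ , k) (k′ , i′)
  MaMu-value-combine i i′ j j′ k k′ =
    ≡.cong₂ (uncurry ∘ MaMu-value) (Fin.remQuot-combine i j) (≡.cong₂ _,_ (Fin.remQuot-combine j′ k) (Fin.remQuot-combine k′ i′))

  outerProduct-presentation : ∀ a c → Presentation (MaMu K a 1 c) (Fin a) (Fin c) (Fin c × Fin a)
  outerProduct-presentation a c = Presentation-map (MaMu-presentation a 1 c) proj₁ proj₂ id
    (λ i k (k′ , i′) → 𝟙[ (i ≟ i′) ×-dec (k ≟ k′) ])
    (λ (i , o) (o′ , k) (k′ , i′) → 𝟙-cong ((i ≟ i′) ×-dec (o ≟ o′) ×-dec (k ≟ k′)) ((i ≟ i′) ×-dec (k ≟ k′))
       (λ (i≡i′ , _ , k≡k′) → i≡i′ , k≡k′) (λ (i≡i′ , k≡k′) → i≡i′ , Fin1-irrelevant o o′ , k≡k′))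

  innerProduct-presentation : ∀ b → Presentation (MaMu K 1 b 1) (Fin b) (Fin b) ⊤
  innerProduct-presentation b = Presentation-map (MaMu-presentation 1 b 1) proj₂ proj₁ (λ _ → tt)
    (λ t t′ _ → 𝟙[ t ≟ t′ ])
    (λ (o₁ , t) (t′ , o₂) (o₃ , o₄) → 𝟙-cong ((o₁ ≟ o₄) ×-dec (t ≟ t′) ×-dec (o₂ ≟ o₃)) (t ≟ t′)
       (λ (_ , t≡t′ , _) → t≡t′) (λ t≡t′ → Fin1-irrelevant o₁ o₄ , t≡t′ , Fin1-irrelevant o₂ o₃))

  ⊕-value : ∀ {X₁ X₂ Y₁ Y₂ Z₁ Z₂ : Set} → (X₁ → Y₁ → Z₁ → Carrier) → (X₂ → Y₂ → Z₂ → Carrier) →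
            X₁ ⊎ X₂ → Y₁ ⊎ Y₂ → Z₁ ⊎ Z₂ → Carrier
  ⊕-value e₁ e₂ (inj₁ x) (inj₁ y) (inj₁ z) = e₁ x y z
  ⊕-value e₁ e₂ (inj₂ x) (inj₂ y) (inj₂ z) = e₂ x y z
  ⊕-value e₁ e₂ _        _        _        = 0#

  ⊕-entry : ∀ T S u v w → entry (_⊕_ K T S) u v w ≡
            ⊕-value (entry T) (entry S) (splitAt (da T) u) (splitAt (db T) v) (splitAt (dc T) w)
  ⊕-entry T S u v w with splitAt (da T) u | splitAt (db T) v | splitAt (dc T) w
  ... | inj₁ _ | inj₁ _ | inj₁ _ = ≡.refl
  ... | inj₁ _ | inj₁ _ | inj₂ _ = ≡.refl
  ... | inj₁ _ | inj₂ _ | _      = ≡.refl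
  ... | inj₂ _ | inj₁ _ | _      = ≡.refl
  ... | inj₂ _ | inj₂ _ | inj₁ _ = ≡.refl
  ... | inj₂ _ | inj₂ _ | inj₂ _ = ≡.refl

  ⊕-presentation : ∀ {T S X₁ X₂ Y₁ Y₂ Z₁ Z₂} → Presentation T X₁ Y₁ Z₁ → Presentation S X₂ Y₂ Z₂ →
                   Presentation (_⊕_ K T S) (X₁ ⊎ X₂) (Y₁ ⊎ Y₂) (Z₁ ⊎ Z₂)
  ⊕-presentation {T} {S} P Q = record
    { decodeX = Sum.map (decodeX P) (decodeX Q) ∘ splitAt (da T)
    ; decodeY = Sum.map (decodeY P) (decodeY Q) ∘ splitAt (db T)
    ; decodeZ = Sum.map (decodeZ P) (decodeZ Q) ∘ splitAt (dc T)
    ; value = ⊕-value (value P) (value Q)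
    ; entry≈value = λ u v w → trans (reflexive (⊕-entry T S u v w)) (decoded (splitAt (da T) u) (splitAt (db T) v) (splitAt (dc T) w))
    }
    where
    decoded : ∀ x y z → ⊕-value (entry T) (entry S) x y z ≈
              ⊕-value (value P) (value Q)
                (Sum.map (decodeX P) (decodeX Q) x) (Sum.map (decodeY P) (decodeY Q) y) (Sum.map (decodeZ P) (decodeZ Q) z)
    decoded (inj₁ x) (inj₁ y) (inj₁ z) = entry≈value P x y z
    decoded (inj₁ x) (inj₁ y) (inj₂ z) = refl
    decoded (inj₁ x) (inj₂ y) z        = refl
    decoded (inj₂ x) (inj₁ y) z        = refl
    decoded (inj₂ x) (inj₂ y) (inj₁ z) = refl
    decoded (inj₂ x) (inj₂ y) (inj₂ z) = entry≈value Q x y z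

  blockDiagonal : ∀ r {X Y Z : Fin r → Set} → (∀ α → X α → Y α → Z α → Carrier) →
                  Σ (Fin r) X → Σ (Fin r) Y → Σ (Fin r) Z → Carrier
  blockDiagonal (suc r) E (zero  , x) (zero  , y) (zero  , z) = E zero x y z
  blockDiagonal (suc r) E (suc α , x) (suc β , y) (suc γ , z) = blockDiagonal r (E ∘ suc) (α , x) (β , y) (γ , z)
  blockDiagonal _       E _           _           _           = 0#

  ⨁-presentation : ∀ r {Ts : Fin r → Tensor K} {X Y Z : Fin r → Set} → (∀ α → Presentation (Ts α) (X α) (Y α) (Z α)) →
                   Presentation (⨁ K r Ts) (Σ (Fin r) X) (Σ (Fin r) Y) (Σ (Fin r) Z)

  -- Stated separately because value (⨁-presentation r P) only unfolds for a concrete r.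
  ⨁-value : ∀ r {Ts : Fin r → Tensor K} {X Y Z : Fin r → Set} (P : ∀ α → Presentation (Ts α) (X α) (Y α) (Z α)) →
            ∀ x y z → value (⨁-presentation r P) x y z ≈ blockDiagonal r (value ∘ P) x y z

  ⨁-presentation zero    P = record
    { decodeX = λ () ; decodeY = λ () ; decodeZ = λ () ; value = λ { (() , _) } ; entry≈value = λ () }
  ⨁-presentation (suc r) P =
    Presentation-map (⊕-presentation (P zero) (⨁-presentation r (P ∘ suc))) cons cons cons
                     (blockDiagonal (suc r) (value ∘ P)) cons-value
    where
    cons : ∀ {W : Fin (suc r) → Set} → W zero ⊎ Σ (Fin r) (W ∘ suc) → Σ (Fin (suc r)) W
    cons = [ zero ,_ , Product.map suc id ]′
    cons-value : ∀ x y z → ⊕-value (value (P zero)) (value (⨁-presentation r (P ∘ suc))) x y z ≈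
                           blockDiagonal (suc r) (value ∘ P) (cons x) (cons y) (cons z)
    cons-value (inj₁ x) (inj₁ y) (inj₁ z) = refl
    cons-value (inj₁ x) (inj₁ y) (inj₂ z) = refl
    cons-value (inj₁ x) (inj₂ y) z        = refl
    cons-value (inj₂ x) (inj₁ y) z        = refl
    cons-value (inj₂ x) (inj₂ y) (inj₁ z) = refl
    cons-value (inj₂ x) (inj₂ y) (inj₂ z) = ⨁-value r (P ∘ suc) x y z

  ⨁-value zero    P (() , _) y z
  ⨁-value (suc r) P x        y z = refl

  blockDiagonal-unique : ∀ r {X Y Z : Fin r → Set} (E : ∀ α → X α → Y α → Z α → Carrier)
                         (F : Σ (Fin r) X → Σ (Fin r) Y → Σ (Fin r) Z → Carrier) →
                         (∀ α x y z → F (α , x) (α , y) (α , z) ≈ E α x y z) →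
                         (∀ {α β γ} x y z → ¬ (α ≡ β × α ≡ γ) → F (α , x) (β , y) (γ , z) ≈ 0#) →
                         ∀ a b c → F a b c ≈ blockDiagonal r E a b c
  blockDiagonal-unique (suc r) E F diag off (zero  , x) (zero  , y) (zero  , z) = diag zero x y z
  blockDiagonal-unique (suc r) E F diag off (suc α , x) (suc β , y) (suc γ , z) =
    blockDiagonal-unique r (E ∘ suc) (λ (α , x) (β , y) (γ , z) → F (suc α , x) (suc β , y) (suc γ , z))
      (diag ∘ suc) (λ x y z mismatch → off x y z (mismatch ∘ Product.map Fin.suc-injective Fin.suc-injective))
      (α , x) (β , y) (γ , z)
  blockDiagonal-unique (suc r) E F diag off (zero  , x) (zero  , y) (suc γ , z) = off x y z λ ()
  blockDiagonal-unique (suc r) E F diag off (zero  , x) (suc β , y) (γ     , z) = off x y z λ ()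
  blockDiagonal-unique (suc r) E F diag off (suc α , x) (zero  , y) (γ     , z) = off x y z λ ()
  blockDiagonal-unique (suc r) E F diag off (suc α , x) (suc β , y) (zero  , z) = off x y z λ ()

  act-as-∑ : ∀ (S : Tensor K) {a′ b′ c′} (A : Mat K a′ (da S)) (B : Mat K b′ (db S)) (C : Mat K c′ (dc S)) u v w →
             act K S A B C u v w ≈ ∑[ x < da S ] ∑[ y < db S ] ∑[ z < dc S ] (A u x * (B v y * (C w z * entry S x y z)))
  act-as-∑ S A B C u v w = Σ[<]≈∑ (da S) λ x → Σ[<]≈∑ (db S) λ y → Σ[<]≈∑ (dc S) λ z → refl

  act-unitT : ∀ r {a′ b′ c′} (A : Mat K a′ r) (B : Mat K b′ r) (C : Mat K c′ r) u v w →
              act K (unitT K r) A B C u v w ≈ ∑[ i < r ] (A u i * (B v i * C w i))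
  act-unitT r A B C u v w = begin
    act K (unitT K r) A B C u v w
      ≈⟨ act-as-∑ (unitT K r) A B C u v w ⟩
    ∑[ i < r ] ∑[ j < r ] ∑[ k < r ] F i j k
      ≈⟨ sum-cong-≋ (λ i → ∑-sift (λ j → ∑[ k < r ] F i j k) i λ j j≢i → ∑-zero λ k → vanish i j k (j≢i ∘ ≡.sym ∘ proj₁)) ⟩
    ∑[ i < r ] ∑[ k < r ] F i i k
      ≈⟨ sum-cong-≋ (λ i → ∑-sift (F i i) i λ k k≢i → vanish i i k (k≢i ∘ ≡.sym ∘ proj₂)) ⟩
    ∑[ i < r ] F i i i
      ≈⟨ sum-cong-≋ (λ i → *-congˡ (*-congˡ (trans (*-congˡ (diagonal i)) (*-identityʳ (C w i))))) ⟩
    ∑[ i < r ] (A u i * (B v i * C w i)) ∎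
    where
    F : Fin r → Fin r → Fin r → Carrier
    F i j k = A u i * (B v j * (C w k * δ K (⌊ i ≟ j ⌋ ∧ ⌊ j ≟ k ⌋)))
    vanish : ∀ i j k → ¬ (i ≡ j × j ≡ k) → F i j k ≈ 0#
    vanish i j k h = *-zero₃ (A u i) (B v j)
      (trans (*-congˡ (trans (δ-∧-𝟙 (i ≟ j) (j ≟ k)) (𝟙-no ((i ≟ j) ×-dec (j ≟ k)) h))) (zeroʳ (C w k)))
    diagonal : ∀ i → δ K (⌊ i ≟ i ⌋ ∧ ⌊ i ≟ i ⌋) ≈ 1#
    diagonal i = trans (δ-∧-𝟙 (i ≟ i) (i ≟ i)) (𝟙-yes ((i ≟ i) ×-dec (i ≟ i)) (≡.refl , ≡.refl))

  act-MaMu : ∀ a b c {a′ b′ c′} (A : Mat K a′ (a ℕ.* b)) (B : Mat K b′ (b ℕ.* c)) (C : Mat K c′ (c ℕ.* a)) u v w →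
             act K (MaMu K a b c) A B C u v w ≈
             ∑[ i < a ] ∑[ j < b ] ∑[ k < c ] (A u (combine i j) * (B v (combine j k) * C w (combine k i)))
  act-MaMu a b c A B C u v w = begin
    act K (MaMu K a b c) A B C u v w
      ≈⟨ act-as-∑ (MaMu K a b c) A B C u v w ⟩
    ∑[ x < a ℕ.* b ] ∑[ y < b ℕ.* c ] ∑[ z < c ℕ.* a ] G x y z
      ≈⟨ ∑-combine a _ ⟩
    ∑[ i < a ] ∑[ j < b ] ∑[ y < b ℕ.* c ] ∑[ z < c ℕ.* a ] G (combine i j) y z
      ≈⟨ sum-cong-≋ (λ i → sum-cong-≋ λ j → trans (∑-combine b _) (sum-cong-≋ λ j′ → sum-cong-≋ λ k →
           trans (∑-combine c _) (sum-cong-≋ λ k′ → sum-cong-≋ λ i′ → *-congˡ (*-congˡ (*-congˡ (entry≈𝟙 i i′ j j′ k k′)))))) ⟩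
    ∑[ i < a ] ∑[ j < b ] ∑[ j′ < b ] ∑[ k < c ] ∑[ k′ < c ] ∑[ i′ < a ] F i j j′ k k′ i′
      ≈⟨ sum-cong-≋ (λ i → sum-cong-≋ λ j → ∑-sift _ j λ j′ j′≢j → ∑-zero λ k → ∑-zero λ k′ → ∑-zero λ i′ →
           vanish i j j′ k k′ i′ (j′≢j ∘ ≡.sym ∘ proj₁ ∘ proj₂)) ⟩
    ∑[ i < a ] ∑[ j < b ] ∑[ k < c ] ∑[ k′ < c ] ∑[ i′ < a ] F i j j k k′ i′
      ≈⟨ sum-cong-≋ (λ i → sum-cong-≋ λ j → sum-cong-≋ λ k → ∑-sift _ k λ k′ k′≢k → ∑-zero λ i′ →
           vanish i j j k k′ i′ (k′≢k ∘ ≡.sym ∘ proj₂ ∘ proj₂)) ⟩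
    ∑[ i < a ] ∑[ j < b ] ∑[ k < c ] ∑[ i′ < a ] F i j j k k i′
      ≈⟨ sum-cong-≋ (λ i → sum-cong-≋ λ j → sum-cong-≋ λ k → ∑-sift _ i λ i′ i′≢i →
           vanish i j j k k i′ (i′≢i ∘ ≡.sym ∘ proj₁)) ⟩
    ∑[ i < a ] ∑[ j < b ] ∑[ k < c ] F i j j k k i
      ≈⟨ sum-cong-≋ (λ i → sum-cong-≋ λ j → sum-cong-≋ λ k → *-congˡ (*-congˡ
           (trans (*-congˡ (𝟙-yes (i≟i′×j≟j′×k≟k′ i i j j k k) (≡.refl , ≡.refl , ≡.refl))) (*-identityʳ _)))) ⟩
    ∑[ i < a ] ∑[ j < b ] ∑[ k < c ] (A u (combine i j) * (B v (combine j k) * C w (combine k i))) ∎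
    where
    i≟i′×j≟j′×k≟k′ : ∀ (i : Fin a) i′ (j : Fin b) j′ (k : Fin c) k′ → Dec (i ≡ i′ × j ≡ j′ × k ≡ k′)
    i≟i′×j≟j′×k≟k′ i i′ j j′ k k′ = (i ≟ i′) ×-dec (j ≟ j′) ×-dec (k ≟ k′)
    F : Fin a → Fin b → Fin b → Fin c → Fin c → Fin a → Carrier
    F i j j′ k k′ i′ = A u (combine i j) * (B v (combine j′ k) * (C w (combine k′ i′) * 𝟙[ i≟i′×j≟j′×k≟k′ i i′ j j′ k k′ ]))
    G : Fin (a ℕ.* b) → Fin (b ℕ.* c) → Fin (c ℕ.* a) → Carrier
    G x y z = A u x * (B v y * (C w z * entry (MaMu K a b c) x y z))
    entry≈𝟙 : ∀ i i′ j j′ k k′ → entry (MaMu K a b c) (combine i j) (combine j′ k) (combine k′ i′) ≈ 𝟙[ i≟i′×j≟j′×k≟k′ i i′ j j′ k k′ ]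
    entry≈𝟙 i i′ j j′ k k′ =
      trans (entry≈value (MaMu-presentation a b c) _ _ _) (reflexive (MaMu-value-combine i i′ j j′ k k′))
    vanish : ∀ i j j′ k k′ i′ → ¬ (i ≡ i′ × j ≡ j′ × k ≡ k′) → F i j j′ k k′ i′ ≈ 0#
    vanish i j j′ k k′ i′ h = *-zero₃ (A u (combine i j)) (B v (combine j′ k))
      (trans (*-congˡ (𝟙-no (i≟i′×j≟j′×k≟k′ i i′ j j′ k k′) h)) (zeroʳ _))

  module _ (T S : Tensor K) where

    ⊕-entry-↑ˡ : ∀ i j k → entry (_⊕_ K T S) (i ↑ˡ da S) (j ↑ˡ db S) (k ↑ˡ dc S) ≡ entry T i j k
    ⊕-entry-↑ˡ i j k
      rewrite Fin.splitAt-↑ˡ (da T) i (da S) | Fin.splitAt-↑ˡ (db T) j (db S) | Fin.splitAt-↑ˡ (dc T) k (dc S) = ≡.refl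

    ⊕-entry-↑ʳ : ∀ i j k → entry (_⊕_ K T S) (da T ↑ʳ i) (db T ↑ʳ j) (dc T ↑ʳ k) ≡ entry S i j k
    ⊕-entry-↑ʳ i j k
      rewrite Fin.splitAt-↑ʳ (da T) (da S) i | Fin.splitAt-↑ʳ (db T) (db S) j | Fin.splitAt-↑ʳ (dc T) (dc S) k = ≡.refl

    ⊕-entry-↑ˡ↑ʳ : ∀ i j z → entry (_⊕_ K T S) (i ↑ˡ da S) (db T ↑ʳ j) z ≡ 0#
    ⊕-entry-↑ˡ↑ʳ i j z
      rewrite Fin.splitAt-↑ˡ (da T) i (da S) | Fin.splitAt-↑ʳ (db T) (db S) j = ≡.refl

    ⊕-entry-↑ˡ↑ˡ↑ʳ : ∀ i j k → entry (_⊕_ K T S) (i ↑ˡ da S) (j ↑ˡ db S) (dc T ↑ʳ k) ≡ 0#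
    ⊕-entry-↑ˡ↑ˡ↑ʳ i j k
      rewrite Fin.splitAt-↑ˡ (da T) i (da S) | Fin.splitAt-↑ˡ (db T) j (db S) | Fin.splitAt-↑ʳ (dc T) (dc S) k = ≡.refl

    ⊕-entry-↑ʳ↑ˡ : ∀ i j z → entry (_⊕_ K T S) (da T ↑ʳ i) (j ↑ˡ db S) z ≡ 0#
    ⊕-entry-↑ʳ↑ˡ i j z
      rewrite Fin.splitAt-↑ʳ (da T) (da S) i | Fin.splitAt-↑ˡ (db T) j (db S) = ≡.refl

    ⊕-entry-↑ʳ↑ʳ↑ˡ : ∀ i j k → entry (_⊕_ K T S) (da T ↑ʳ i) (db T ↑ʳ j) (k ↑ˡ dc S) ≡ 0#
    ⊕-entry-↑ʳ↑ʳ↑ˡ i j k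
      rewrite Fin.splitAt-↑ʳ (da T) (da S) i | Fin.splitAt-↑ʳ (db T) (db S) j | Fin.splitAt-↑ˡ (dc T) k (dc S) = ≡.refl

    act-⊕ : ∀ {a′ b′ c′} (A : Mat K a′ (da T ℕ.+ da S)) (B : Mat K b′ (db T ℕ.+ db S)) (C : Mat K c′ (dc T ℕ.+ dc S)) u v w →
            act K (_⊕_ K T S) A B C u v w ≈
            act K T (λ u′ i → A u′ (i ↑ˡ da S)) (λ v′ j → B v′ (j ↑ˡ db S)) (λ w′ k → C w′ (k ↑ˡ dc S)) u v w +
            act K S (λ u′ i → A u′ (da T ↑ʳ i)) (λ v′ j → B v′ (db T ↑ʳ j)) (λ w′ k → C w′ (dc T ↑ʳ k)) u v w
    act-⊕ {a′} {b′} {c′} A B C u v w = begin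
      act K (_⊕_ K T S) A B C u v w
        ≈⟨ act-as-∑ (_⊕_ K T S) A B C u v w ⟩
      ∑[ x < da T ℕ.+ da S ] ∑[ y < db T ℕ.+ db S ] ∑[ z < dc T ℕ.+ dc S ] G x y z
        ≈⟨ ∑-↑ (da T) _ ⟩
      ∑[ i < da T ] ∑[ y < db T ℕ.+ db S ] ∑[ z < dc T ℕ.+ dc S ] G (i ↑ˡ da S) y z +
      ∑[ i < da S ] ∑[ y < db T ℕ.+ db S ] ∑[ z < dc T ℕ.+ dc S ] G (da T ↑ʳ i) y z
        ≈⟨ +-cong (sum-cong-≋ left-block) (sum-cong-≋ right-block) ⟩
      ∑[ i < da T ] ∑[ j < db T ] ∑[ k < dc T ] G (i ↑ˡ da S) (j ↑ˡ db S) (k ↑ˡ dc S) +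
      ∑[ i < da S ] ∑[ j < db S ] ∑[ k < dc S ] G (da T ↑ʳ i) (db T ↑ʳ j) (dc T ↑ʳ k)
        ≈⟨ +-cong (sum-cong-≋ λ i → sum-cong-≋ λ j → sum-cong-≋ λ k → vary (⊕-entry-↑ˡ i j k))
                  (sum-cong-≋ λ i → sum-cong-≋ λ j → sum-cong-≋ λ k → vary (⊕-entry-↑ʳ i j k)) ⟩
      _ + _
        ≈⟨ +-cong (act-as-∑ T Aˡ Bˡ Cˡ u v w) (act-as-∑ S Aʳ Bʳ Cʳ u v w) ⟨
      act K T Aˡ Bˡ Cˡ u v w + act K S Aʳ Bʳ Cʳ u v w ∎
      where
      Aˡ : Mat K a′ (da T)
      Aˡ u′ i = A u′ (i ↑ˡ da S)
      Bˡ : Mat K b′ (db T)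
      Bˡ v′ j = B v′ (j ↑ˡ db S)
      Cˡ : Mat K c′ (dc T)
      Cˡ w′ k = C w′ (k ↑ˡ dc S)
      Aʳ : Mat K a′ (da S)
      Aʳ u′ i = A u′ (da T ↑ʳ i)
      Bʳ : Mat K b′ (db S)
      Bʳ v′ j = B v′ (db T ↑ʳ j)
      Cʳ : Mat K c′ (dc S)
      Cʳ w′ k = C w′ (dc T ↑ʳ k)
      G : Fin (da T ℕ.+ da S) → Fin (db T ℕ.+ db S) → Fin (dc T ℕ.+ dc S) → Carrier
      G x y z = A u x * (B v y * (C w z * entry (_⊕_ K T S) x y z))
      vary : ∀ {x y z e} → entry (_⊕_ K T S) x y z ≡ e → G x y z ≈ A u x * (B v y * (C w z * e))
      vary eq = *-congˡ (*-congˡ (*-congˡ (reflexive eq)))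
      vanish : ∀ {x y z} → entry (_⊕_ K T S) x y z ≡ 0# → G x y z ≈ 0#
      vanish eq = *-zero₃ _ _ (trans (*-congˡ (reflexive eq)) (zeroʳ _))
      left-block : ∀ i → ∑[ y < db T ℕ.+ db S ] ∑[ z < dc T ℕ.+ dc S ] G (i ↑ˡ da S) y z ≈
                         ∑[ j < db T ] ∑[ k < dc T ] G (i ↑ˡ da S) (j ↑ˡ db S) (k ↑ˡ dc S)
      left-block i = trans (∑-↑-vanishingʳ (db T) _ λ j → ∑-zero λ z → vanish (⊕-entry-↑ˡ↑ʳ i j z))
                           (sum-cong-≋ λ j → ∑-↑-vanishingʳ (dc T) _ λ k → vanish (⊕-entry-↑ˡ↑ˡ↑ʳ i j k))
      right-block : ∀ i → ∑[ y < db T ℕ.+ db S ] ∑[ z < dc T ℕ.+ dc S ] G (da T ↑ʳ i) y z ≈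
                          ∑[ j < db S ] ∑[ k < dc S ] G (da T ↑ʳ i) (db T ↑ʳ j) (dc T ↑ʳ k)
      right-block i = trans (∑-↑-vanishingˡ (db T) _ λ j → ∑-zero λ z → vanish (⊕-entry-↑ʳ↑ˡ i j z))
                            (sum-cong-≋ λ j → ∑-↑-vanishingˡ (dc T) _ λ k → vanish (⊕-entry-↑ʳ↑ʳ↑ˡ i j k))

  0ᴹ : ∀ {m n} → Mat K m n
  0ᴹ _ _ = 0#

  module _ (S : Tensor K) {a′ b′ c′ : ℕ} where

    private
      act-vanishing : (A : Mat K a′ (da S)) (B : Mat K b′ (db S)) (C : Mat K c′ (dc S)) → ∀ u v w →
                      (∀ x y z → A u x * (B v y * (C w z * entry S x y z)) ≈ 0#) → act K S A B C u v w ≈ 0#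
      act-vanishing A B C u v w vanish = trans (act-as-∑ S A B C u v w) (∑-zero λ x → ∑-zero λ y → ∑-zero λ z → vanish x y z)

    act-zeroᴬ : (B : Mat K b′ (db S)) (C : Mat K c′ (dc S)) → ∀ u v w → act K S 0ᴹ B C u v w ≈ 0#
    act-zeroᴬ B C u v w = act-vanishing 0ᴹ B C u v w λ x y z → zeroˡ _

    act-zeroᴮ : (A : Mat K a′ (da S)) (C : Mat K c′ (dc S)) → ∀ u v w → act K S A 0ᴹ C u v w ≈ 0#
    act-zeroᴮ A C u v w = act-vanishing A 0ᴹ C u v w λ x y z → trans (*-congˡ (zeroˡ _)) (zeroʳ _)

    act-zeroᶜ : (A : Mat K a′ (da S)) (B : Mat K b′ (db S)) → ∀ u v w → act K S A B 0ᴹ u v w ≈ 0#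
    act-zeroᶜ A B u v w = act-vanishing A B 0ᴹ u v w λ x y z → *-zero₃ _ _ (zeroˡ _)

  quadratic-⊴ : ∀ {T S} (A₀ A₁ : Mat K (da T) (da S)) (B₀ B₁ : Mat K (db T) (db S)) (C₀ C₂ : Mat K (dc T) (dc S)) →
                (∀ u v w → act K S A₀ B₀ C₀ u v w ≈ 0#) →
                (∀ u v w → act K S A₀ B₁ C₀ u v w + act K S A₁ B₀ C₀ u v w ≈ 0#) →
                (∀ u v w → act K S A₀ B₀ C₂ u v w + act K S A₁ B₁ C₀ u v w ≈ entry T u v w) →
                _⊴_ K T S
  quadratic-⊴ {T} {S} A₀ A₁ B₀ B₁ C₀ C₂ ε⁰ ε¹ ε² = 2 , A , B , C , below-2 , at-2
    where
    A : ℕ → Mat K (da T) (da S)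
    A 0 = A₀
    A 1 = A₁
    A _ = 0ᴹ
    B : ℕ → Mat K (db T) (db S)
    B 0 = B₀
    B 1 = B₁
    B _ = 0ᴹ
    C : ℕ → Mat K (dc T) (dc S)
    C 0 = C₀
    C 2 = C₂
    C _ = 0ᴹ
    below-2 : ∀ d → d < 2 → ∀ u v w → coeff K S A B C d u v w ≈ 0#
    below-2 0 _ = ε⁰
    below-2 1 _ u v w = trans (+-congʳ (trans (+-congʳ (act-zeroᶜ S A₀ B₀ u v w)) (+-identityˡ _))) (ε¹ u v w)
    below-2 (suc (suc _)) (ℕ.s≤s (ℕ.s≤s ()))
    at-2 : ∀ u v w → coeff K S A B C 2 u v w ≈ entry T u v w
    at-2 u v w = begin
      ((act K S A₀ B₀ C₂ u v w + act K S A₀ B₁ 0ᴹ u v w) + act K S A₀ 0ᴹ C₀ u v w) +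
      (act K S A₁ B₀ 0ᴹ u v w + act K S A₁ B₁ C₀ u v w) + act K S 0ᴹ B₀ C₀ u v w
        ≈⟨ +-cong (+-cong (+-cong (+-congˡ (act-zeroᶜ S A₀ B₁ u v w)) (act-zeroᴮ S A₀ C₀ u v w))
                          (+-congʳ (act-zeroᶜ S A₁ B₀ u v w)))
                  (act-zeroᴬ S B₀ C₀ u v w) ⟩
      ((act K S A₀ B₀ C₂ u v w + 0#) + 0#) + (0# + act K S A₁ B₁ C₀ u v w) + 0#
        ≈⟨ trans (+-identityʳ _) (+-cong (trans (+-identityʳ _) (+-identityʳ _)) (+-identityˡ _)) ⟩
      act K S A₀ B₀ C₂ u v w + act K S A₁ B₁ C₀ u v w
        ≈⟨ ε² u v w ⟩
      entry T u v w ∎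

  -- The construction

  module Construction {p q : ℕ} (nα : Fin p → ℕ) (mβ : Fin q → ℕ) where

    n m : ℕ
    n = sumℕ p nα
    m = sumℕ q mβ

    s : Fin p → Fin q → ℕ
    s α β = (nα α ∸ 1) ℕ.* (mβ β ∸ 1)

    Source : Tensor K
    Source = _⊕_ K (unitT K (n ℕ.* m)) (MaMu K p 1 q)

    Target : Tensor K
    Target = _⊕_ K (MaMu K n 1 m) (⨁ K p λ α → ⨁ K q λ β → MaMu K 1 (s α β) 1)

    rowX : (Fin n → Fin m → Carrier) → (Fin p → Carrier) → Fin (da Source) → Carrier
    rowX f g = uncurry f ∘ remQuot m ++ g ∘ proj₁ ∘ remQuot 1

    rowY : (Fin n → Fin m → Carrier) → (Fin q → Carrier) → Fin (db Source) → Carrier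
    rowY f g = uncurry f ∘ remQuot m ++ g ∘ proj₂ ∘ remQuot {1} q

    rowZ : (Fin n → Fin m → Carrier) → (Fin p → Fin q → Carrier) → Fin (dc Source) → Carrier
    rowZ f g = uncurry f ∘ remQuot m ++ uncurry (flip g) ∘ remQuot p

    ++-combine-↑ˡ : ∀ {r} (f : Fin n → Fin m → Carrier) (g : Fin r → Carrier) i j →
                    (uncurry f ∘ remQuot m ++ g) (combine i j ↑ˡ r) ≡ f i j
    ++-combine-↑ˡ f g i j =
      ≡.trans (lookup-++ˡ (uncurry f ∘ remQuot m) g (combine i j)) (≡.cong (uncurry f) (Fin.remQuot-combine i j))

    ++-combine-↑ʳ : ∀ {a b} (f : Fin (n ℕ.* m) → Carrier) (h : Fin a × Fin b → Carrier) i j →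
                    (f ++ h ∘ remQuot b) (n ℕ.* m ↑ʳ combine i j) ≡ h (i , j)
    ++-combine-↑ʳ f h i j = ≡.trans (lookup-++ʳ f (h ∘ remQuot _) (combine i j)) (≡.cong h (Fin.remQuot-combine i j))

    act-rows : ∀ {a′ b′ c′} (fa : Fin a′ → Fin n → Fin m → Carrier) (ga : Fin a′ → Fin p → Carrier)
               (fb : Fin b′ → Fin n → Fin m → Carrier) (gb : Fin b′ → Fin q → Carrier)
               (fc : Fin c′ → Fin n → Fin m → Carrier) (gc : Fin c′ → Fin p → Fin q → Carrier) → ∀ u v w →
               act K Source (λ u → rowX (fa u) (ga u)) (λ v → rowY (fb v) (gb v)) (λ w → rowZ (fc w) (gc w)) u v w ≈
               ⟪ fa u , fb v , fc w ⟫ + ⟪ (λ α _ → ga u α) , (λ _ β → gb v β) , gc w ⟫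
    act-rows {a′} {b′} {c′} fa ga fb gb fc gc u v w = begin
      act K Source A B C u v w
        ≈⟨ act-⊕ (unitT K N) (MaMu K p 1 q) A B C u v w ⟩
      act K (unitT K N) Aˡ Bˡ Cˡ u v w + act K (MaMu K p 1 q) Aʳ Bʳ Cʳ u v w
        ≈⟨ +-cong (act-unitT N Aˡ Bˡ Cˡ u v w) (act-MaMu p 1 q Aʳ Bʳ Cʳ u v w) ⟩
      ∑[ k < N ] (Aˡ u k * (Bˡ v k * Cˡ w k)) +
      ∑[ α < p ] ∑[ o < 1 ] ∑[ β < q ] (Aʳ u (combine α o) * (Bʳ v (combine o β) * Cʳ w (combine β α)))
        ≈⟨ +-cong (trans (∑-combine n _) (sum-cong-≋ λ i → sum-cong-≋ λ j → reflexive (unit-part i j)))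
                  (sum-cong-≋ λ α → trans (+-identityʳ _) (sum-cong-≋ λ β → reflexive (MaMu-part α β))) ⟩
      ⟪ fa u , fb v , fc w ⟫ + ⟪ (λ α _ → ga u α) , (λ _ β → gb v β) , gc w ⟫ ∎
      where
      N : ℕ
      N = n ℕ.* m
      A : Mat K a′ (da Source)
      A u = rowX (fa u) (ga u)
      B : Mat K b′ (db Source)
      B v = rowY (fb v) (gb v)
      C : Mat K c′ (dc Source)
      C w = rowZ (fc w) (gc w)
      Aˡ : Mat K a′ N
      Aˡ u k = A u (k ↑ˡ p ℕ.* 1)
      Bˡ : Mat K b′ N
      Bˡ v k = B v (k ↑ˡ 1 ℕ.* q)
      Cˡ : Mat K c′ N
      Cˡ w k = C w (k ↑ˡ q ℕ.* p)
      Aʳ : Mat K a′ (p ℕ.* 1)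
      Aʳ u k = A u (N ↑ʳ k)
      Bʳ : Mat K b′ (1 ℕ.* q)
      Bʳ v k = B v (N ↑ʳ k)
      Cʳ : Mat K c′ (q ℕ.* p)
      Cʳ w k = C w (N ↑ʳ k)
      unit-part : ∀ i j → Aˡ u (combine i j) * (Bˡ v (combine i j) * Cˡ w (combine i j)) ≡ fa u i j * (fb v i j * fc w i j)
      unit-part i j = ≡.cong₂ _*_ (++-combine-↑ˡ (fa u) (ga u ∘ proj₁ ∘ remQuot 1) i j)
        (≡.cong₂ _*_ (++-combine-↑ˡ (fb v) (gb v ∘ proj₂ ∘ remQuot {1} q) i j)
                     (++-combine-↑ˡ (fc w) (uncurry (flip (gc w)) ∘ remQuot p) i j))
      MaMu-part : ∀ α β → Aʳ u (combine α zero) * (Bʳ v (combine {1} zero β) * Cʳ w (combine β α)) ≡ ga u α * (gb v β * gc w α β)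
      MaMu-part α β = ≡.cong₂ _*_ (++-combine-↑ʳ (uncurry (fa u) ∘ remQuot m) (ga u ∘ proj₁) α zero)
        (≡.cong₂ _*_ (++-combine-↑ʳ {1} (uncurry (fb v) ∘ remQuot m) (gb v ∘ proj₂) zero β)
                     (++-combine-↑ʳ (uncurry (fc w) ∘ remQuot m) (uncurry (flip (gc w))) β α))

    Blocks : (Fin p → Fin q → Set) → Set
    Blocks W = Σ (Fin p) λ α → Σ (Fin q) (W α)

    TX TY TZ : Set
    TX = Fin n ⊎ Blocks (λ α β → Fin (s α β))
    TY = Fin m ⊎ Blocks (λ α β → Fin (s α β))
    TZ = (Fin m × Fin n) ⊎ Blocks (λ _ _ → ⊤)

    blocks-presentation : Presentation (⨁ K p λ α → ⨁ K q λ β → MaMu K 1 (s α β) 1)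
                            (Blocks λ α β → Fin (s α β)) (Blocks λ α β → Fin (s α β)) (Blocks λ _ _ → ⊤)
    blocks-presentation = ⨁-presentation p λ α → ⨁-presentation q λ β → innerProduct-presentation (s α β)

    Target-presentation : Presentation Target TX TY TZ
    Target-presentation = ⊕-presentation (outerProduct-presentation n m) blocks-presentation

    inBlock? : ∀ α β i j → Dec (block nα i ≡ α × block mβ j ≡ β)
    inBlock? α β i j = (block nα i ≟ α) ×-dec (block mβ j ≟ β)

    𝟙ᴮ : Fin p → Fin q → Fin n → Fin m → Carrier
    𝟙ᴮ α β i j = 𝟙[ inBlock? α β i j ]

    t₁ : ∀ {α β} → Fin (s α β) → ℕ
    t₁ {α} {β} t = toℕ (proj₁ (remQuot {nα α ∸ 1} (mβ β ∸ 1) t))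

    t₂ : ∀ {α β} → Fin (s α β) → ℕ
    t₂ {α} {β} t = toℕ (proj₂ (remQuot {nα α ∸ 1} (mβ β ∸ 1) t))

    U V : ∀ α β → Fin (s α β) → Fin n → Fin m → Carrier
    U α β t i j = 𝟙ᴮ α β i j * (𝟙[ offset mβ j ℕ.≟ t₂ t ] * diffLast (nα α) (t₁ t) (offset nα i))
    V α β t i j = 𝟙ᴮ α β i j * (𝟙[ offset nα i ℕ.≟ t₁ t ] * diffLast (mβ β) (t₂ t) (offset mβ j))

    t₁<nα-1 : ∀ {α β} (t : Fin (s α β)) → t₁ t < nα α ∸ 1
    t₁<nα-1 t = Fin.toℕ<n _

    t₂<mβ-1 : ∀ {α β} (t : Fin (s α β)) → t₂ t < mβ β ∸ 1
    t₂<mβ-1 t = Fin.toℕ<n _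

    -- Entries of A₀, A₁, B₀, B₁, C₀, C₂ in a decoded target row; the primed ones on the ⟨p,1,q⟩ part of the source.
    a₀ a₁ : TX → Fin n → Fin m → Carrier
    a₀ (inj₁ i′)          i _ = 𝟙[ i ≟ i′ ]
    a₀ (inj₂ _)           _ _ = 0#
    a₁ (inj₁ _)           _ _ = 0#
    a₁ (inj₂ (α , β , t))     = U α β t

    b₀ b₁ : TY → Fin n → Fin m → Carrier
    b₀ (inj₁ j′)          _ j = 𝟙[ j ≟ j′ ]
    b₀ (inj₂ _)           _ _ = 0#
    b₁ (inj₁ _)           _ _ = 0#
    b₁ (inj₂ (α , β , t))     = V α β t

    c₀ c₂ : TZ → Fin n → Fin m → Carrier
    c₀ (inj₁ _)           _ _ = 0#
    c₀ (inj₂ (α , β , _))     = 𝟙ᴮ α β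
    c₂ (inj₁ (j′ , i′))   i j = 𝟙[ (i ≟ i′) ×-dec (j ≟ j′) ]
    c₂ (inj₂ _)           _ _ = 0#

    a₀′ : TX → Fin p → Carrier
    a₀′ (inj₁ i′) α = 𝟙[ α ≟ block nα i′ ]
    a₀′ (inj₂ _)  _ = 0#

    b₀′ : TY → Fin q → Carrier
    b₀′ (inj₁ j′) β = 𝟙[ β ≟ block mβ j′ ]
    b₀′ (inj₂ _)  _ = 0#

    c₀′ : TZ → Fin p → Fin q → Carrier
    c₀′ (inj₁ _)           _  _  = 0#
    c₀′ (inj₂ (α , β , _)) α′ β′ = - 𝟙[ (α′ ≟ α) ×-dec (β′ ≟ β) ]

    ∑-U-𝟙ᴮ : ∀ α β t j α′ β′ → ∑[ i < n ] (U α β t i j * 𝟙ᴮ α′ β′ i j) ≈ 0#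
    ∑-U-𝟙ᴮ α β t j α′ β′ = begin
      ∑[ i < n ] (U α β t i j * 𝟙ᴮ α′ β′ i j)
        ≈⟨ sum-cong-≋ regroup ⟩
      ∑[ i < n ] (column * (𝟙[ block nα i ≟ α ] * (diffLast (nα α) (t₁ t) (offset nα i) * 𝟙[ block nα i ≟ α′ ])))
        ≈⟨ ∑-*ˡ {n} column _ ⟩
      column * ∑[ i < n ] (𝟙[ block nα i ≟ α ] * (diffLast (nα α) (t₁ t) (offset nα i) * 𝟙[ block nα i ≟ α′ ]))
        ≈⟨ *-congˡ (∑-𝟙-block-diffLast nα α (t₁<nα-1 t) (λ γ → 𝟙[ γ ≟ α′ ])) ⟩
      column * 0#
        ≈⟨ zeroʳ column ⟩
      0# ∎
      where
      column : Carrier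
      column = 𝟙[ block mβ j ≟ β ] * (𝟙[ offset mβ j ℕ.≟ t₂ t ] * 𝟙[ block mβ j ≟ β′ ])
      regroup : ∀ i → U α β t i j * 𝟙ᴮ α′ β′ i j ≈
                      column * (𝟙[ block nα i ≟ α ] * (diffLast (nα α) (t₁ t) (offset nα i) * 𝟙[ block nα i ≟ α′ ]))
      regroup i = trans (*-cong (*-congʳ (𝟙-×-dec (block nα i ≟ α) (block mβ j ≟ β))) (𝟙-×-dec (block nα i ≟ α′) (block mβ j ≟ β′)))
        (solve 6 (λ a b t d a′ b′ → ((a · b) · (t · d)) · (a′ · b′) ⊜ (b · (t · b′)) · (a · (d · a′))) refl
          𝟙[ block nα i ≟ α ] 𝟙[ block mβ j ≟ β ] 𝟙[ offset mβ j ℕ.≟ t₂ t ] (diffLast (nα α) (t₁ t) (offset nα i))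
          𝟙[ block nα i ≟ α′ ] 𝟙[ block mβ j ≟ β′ ])

    ∑-V-𝟙ᴮ : ∀ α β t i α′ β′ → ∑[ j < m ] (V α β t i j * 𝟙ᴮ α′ β′ i j) ≈ 0#
    ∑-V-𝟙ᴮ α β t i α′ β′ = begin
      ∑[ j < m ] (V α β t i j * 𝟙ᴮ α′ β′ i j)
        ≈⟨ sum-cong-≋ regroup ⟩
      ∑[ j < m ] (row * (𝟙[ block mβ j ≟ β ] * (diffLast (mβ β) (t₂ t) (offset mβ j) * 𝟙[ block mβ j ≟ β′ ])))
        ≈⟨ ∑-*ˡ {m} row _ ⟩
      row * ∑[ j < m ] (𝟙[ block mβ j ≟ β ] * (diffLast (mβ β) (t₂ t) (offset mβ j) * 𝟙[ block mβ j ≟ β′ ]))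
        ≈⟨ *-congˡ (∑-𝟙-block-diffLast mβ β (t₂<mβ-1 t) (λ γ → 𝟙[ γ ≟ β′ ])) ⟩
      row * 0#
        ≈⟨ zeroʳ row ⟩
      0# ∎
      where
      row : Carrier
      row = 𝟙[ block nα i ≟ α ] * (𝟙[ offset nα i ℕ.≟ t₁ t ] * 𝟙[ block nα i ≟ α′ ])
      regroup : ∀ j → V α β t i j * 𝟙ᴮ α′ β′ i j ≈
                      row * (𝟙[ block mβ j ≟ β ] * (diffLast (mβ β) (t₂ t) (offset mβ j) * 𝟙[ block mβ j ≟ β′ ]))
      regroup j = trans (*-cong (*-congʳ (𝟙-×-dec (block nα i ≟ α) (block mβ j ≟ β))) (𝟙-×-dec (block nα i ≟ α′) (block mβ j ≟ β′)))
        (solve 6 (λ a b s d a′ b′ → ((a · b) · (s · d)) · (a′ · b′) ⊜ (a · (s · a′)) · (b · (d · b′))) refl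
          𝟙[ block nα i ≟ α ] 𝟙[ block mβ j ≟ β ] 𝟙[ offset nα i ℕ.≟ t₁ t ] (diffLast (mβ β) (t₂ t) (offset mβ j))
          𝟙[ block nα i ≟ α′ ] 𝟙[ block mβ j ≟ β′ ])

    ⟪U,V,𝟙ᴮ⟫-offDiagonal : ∀ {α β α′ β′ α″ β″} t t′ → ¬ (α ≡ α′ × β ≡ β′ × α ≡ α″ × β ≡ β″) →
                           ⟪ U α β t , V α′ β′ t′ , 𝟙ᴮ α″ β″ ⟫ ≈ 0#
    ⟪U,V,𝟙ᴮ⟫-offDiagonal {α} {β} {α′} {β′} {α″} {β″} t t′ ¬same = ∑-zero {n} λ i → ∑-zero {m} λ j → begin
      U α β t i j * (V α′ β′ t′ i j * 𝟙ᴮ α″ β″ i j)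
        ≈⟨ solve 5 (λ b x b′ y b″ → (b · x) · ((b′ · y) · b″) ⊜ (b · (b′ · b″)) · (x · y)) refl
             (𝟙ᴮ α β i j) (𝟙[ offset mβ j ℕ.≟ t₂ t ] * diffLast (nα α) (t₁ t) (offset nα i))
             (𝟙ᴮ α′ β′ i j) (𝟙[ offset nα i ℕ.≟ t₁ t′ ] * diffLast (mβ β′) (t₂ t′) (offset mβ j)) (𝟙ᴮ α″ β″ i j) ⟩
      (𝟙ᴮ α β i j * (𝟙ᴮ α′ β′ i j * 𝟙ᴮ α″ β″ i j)) * _
        ≈⟨ *-congʳ (trans (*-congˡ (sym (𝟙-×-dec (inBlock? α′ β′ i j) (inBlock? α″ β″ i j))))
                          (trans (sym (𝟙-×-dec (inBlock? α β i j) (inBlock? α′ β′ i j ×-dec inBlock? α″ β″ i j)))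
                                 (𝟙-no (inBlock? α β i j ×-dec inBlock? α′ β′ i j ×-dec inBlock? α″ β″ i j) disjoint))) ⟩
      0# * _
        ≈⟨ zeroˡ _ ⟩
      0# ∎
      where
      disjoint : ∀ {i j} → ¬ ((block nα i ≡ α × block mβ j ≡ β) × (block nα i ≡ α′ × block mβ j ≡ β′) ×
                              (block nα i ≡ α″ × block mβ j ≡ β″))
      disjoint ((i≡α , j≡β) , (i≡α′ , j≡β′) , (i≡α″ , j≡β″)) =
        ¬same (≡.trans (≡.sym i≡α) i≡α′ , ≡.trans (≡.sym j≡β) j≡β′ , ≡.trans (≡.sym i≡α) i≡α″ , ≡.trans (≡.sym j≡β) j≡β″)

    𝟙-t₁-t₂ : ∀ {α β} (t t′ : Fin (s α β)) → 𝟙[ t₁ t′ ℕ.≟ t₁ t ] * 𝟙[ t₂ t ℕ.≟ t₂ t′ ] ≈ 𝟙[ t ≟ t′ ]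
    𝟙-t₁-t₂ {α} {β} t t′ = trans (sym (𝟙-×-dec (t₁ t′ ℕ.≟ t₁ t) (t₂ t ℕ.≟ t₂ t′)))
      (𝟙-cong ((t₁ t′ ℕ.≟ t₁ t) ×-dec (t₂ t ℕ.≟ t₂ t′)) (t ≟ t′) same-coordinates λ { ≡.refl → ≡.refl , ≡.refl })
      where
      same-coordinates : t₁ t′ ≡ t₁ t × t₂ t ≡ t₂ t′ → t ≡ t′
      same-coordinates (e₁ , e₂) =
        ≡.trans (≡.sym (Fin.combine-remQuot {nα α ∸ 1} (mβ β ∸ 1) t))
          (≡.trans (≡.cong₂ combine (Fin.toℕ-injective (≡.sym e₁)) (Fin.toℕ-injective e₂))
                   (Fin.combine-remQuot {nα α ∸ 1} (mβ β ∸ 1) t′))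

    ⟪U,V,𝟙ᴮ⟫-diagonal : ∀ α β (t t′ : Fin (s α β)) → ⟪ U α β t , V α β t′ , 𝟙ᴮ α β ⟫ ≈ 𝟙[ t ≟ t′ ]
    ⟪U,V,𝟙ᴮ⟫-diagonal α β t t′ = begin
      ∑[ i < n ] ∑[ j < m ] (U α β t i j * (V α β t′ i j * 𝟙ᴮ α β i j))
        ≈⟨ sum-cong-≋ (λ i → trans (sum-cong-≋ (regroup i)) (∑-*ˡ {m} 𝟙[ block nα i ≟ α ] _)) ⟩
      ∑[ i < n ] (𝟙[ block nα i ≟ α ] * ∑[ j < m ] (𝟙[ block mβ j ≟ β ] * R i j))
        ≈⟨ ∑-𝟙-block nα α (λ i → ∑[ j < m ] (𝟙[ block mβ j ≟ β ] * R i j)) ⟩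
      ∑[ a < nα α ] ∑[ j < m ] (𝟙[ block mβ j ≟ β ] * R (joinBlock nα α a) j)
        ≈⟨ sum-cong-≋ {nα α} (λ a → ∑-𝟙-block mβ β (R (joinBlock nα α a))) ⟩
      ∑[ a < nα α ] ∑[ b < mβ β ] R (joinBlock nα α a) (joinBlock mβ β b)
        ≈⟨ sum-cong-≋ {nα α} (λ a → sum-cong-≋ {mβ β} λ b → R-on-block a b) ⟩
      ∑[ a < nα α ] ∑[ b < mβ β ] (F (toℕ a) * G (toℕ b))
        ≈⟨ ∑-*-∑ {nα α} {mβ β} (F ∘ toℕ) (G ∘ toℕ) ⟩
      ∑[ a < nα α ] F (toℕ a) * ∑[ b < mβ β ] G (toℕ b)
        ≈⟨ *-cong (∑-𝟙-diffLast {nα α} (t₁ t) (t₁<nα-1 t′)) (∑-𝟙-diffLast {mβ β} (t₂ t′) (t₂<mβ-1 t)) ⟩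
      𝟙[ t₁ t′ ℕ.≟ t₁ t ] * 𝟙[ t₂ t ℕ.≟ t₂ t′ ]
        ≈⟨ 𝟙-t₁-t₂ t t′ ⟩
      𝟙[ t ≟ t′ ] ∎
      where
      F G : ℕ → Carrier
      F a = 𝟙[ a ℕ.≟ t₁ t′ ] * diffLast (nα α) (t₁ t) a
      G b = 𝟙[ b ℕ.≟ t₂ t ] * diffLast (mβ β) (t₂ t′) b
      R : Fin n → Fin m → Carrier
      R i j = (𝟙ᴮ α β i j * 𝟙ᴮ α β i j) * (F (offset nα i) * G (offset mβ j))
      regroup : ∀ i j → U α β t i j * (V α β t′ i j * 𝟙ᴮ α β i j) ≈ 𝟙[ block nα i ≟ α ] * (𝟙[ block mβ j ≟ β ] * R i j)
      regroup i j = trans (*-congʳ (*-congʳ (𝟙-×-dec (block nα i ≟ α) (block mβ j ≟ β))))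
        (solve 7 (λ a b e x d y d′ → ((a · b) · (x · d)) · ((e · (y · d′)) · e) ⊜ a · (b · ((e · e) · ((y · d) · (x · d′))))) refl
          𝟙[ block nα i ≟ α ] 𝟙[ block mβ j ≟ β ] (𝟙ᴮ α β i j)
          𝟙[ offset mβ j ℕ.≟ t₂ t ] (diffLast (nα α) (t₁ t) (offset nα i))
          𝟙[ offset nα i ℕ.≟ t₁ t′ ] (diffLast (mβ β) (t₂ t′) (offset mβ j)))
      R-on-block : ∀ a b → R (joinBlock nα α a) (joinBlock mβ β b) ≈ F (toℕ a) * G (toℕ b)
      R-on-block a b = begin
        (𝟙ᴮ α β i j * 𝟙ᴮ α β i j) * (F (offset nα i) * G (offset mβ j))
          ≈⟨ *-congʳ (*-cong in-block in-block) ⟩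
        (1# * 1#) * (F (offset nα i) * G (offset mβ j))
          ≈⟨ trans (*-congʳ (*-identityˡ 1#)) (*-identityˡ _) ⟩
        F (offset nα i) * G (offset mβ j)
          ≡⟨ ≡.cong₂ (λ x y → F x * G y) (offset-joinBlock nα α a) (offset-joinBlock mβ β b) ⟩
        F (toℕ a) * G (toℕ b) ∎
        where
        i = joinBlock nα α a
        j = joinBlock mβ β b
        in-block : 𝟙ᴮ α β i j ≈ 1#
        in-block = 𝟙-yes (inBlock? α β i j) (block-joinBlock nα α a , block-joinBlock mβ β b)

    ε⁰-coefficient : ∀ x y z → ⟪ a₀ x , b₀ y , c₀ z ⟫ + ⟪ (λ α _ → a₀′ x α) , (λ _ β → b₀′ y β) , c₀′ z ⟫ ≈ 0#
    ε⁰-coefficient (inj₂ _)   y         z         = +-≈0 (⟪0,_,_⟫ (b₀ y) (c₀ z)) (⟪0,_,_⟫ (λ _ β → b₀′ y β) (c₀′ z))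
    ε⁰-coefficient x@(inj₁ _) (inj₂ _)  z         = +-≈0 (⟪_,0,_⟫ (a₀ x) (c₀ z)) (⟪_,0,_⟫ (λ α _ → a₀′ x α) (c₀′ z))
    ε⁰-coefficient x@(inj₁ _) y@(inj₁ _) (inj₁ _) = +-≈0 (⟪_,_,0⟫ (a₀ x) (b₀ y)) (⟪_,_,0⟫ (λ α _ → a₀′ x α) (λ _ β → b₀′ y β))
    ε⁰-coefficient (inj₁ i′) (inj₁ j′) (inj₂ (α , β , _)) = begin
      ⟪ a₀ (inj₁ i′) , b₀ (inj₁ j′) , 𝟙ᴮ α β ⟫ + ⟪ (λ α _ → a₀′ (inj₁ i′) α) , (λ _ β → b₀′ (inj₁ j′) β) , c₀′ (inj₂ (α , β , tt)) ⟫
        ≈⟨ +-cong (⟪𝟙,𝟙,_⟫ i′ j′ (𝟙ᴮ α β)) (⟪𝟙,𝟙,_⟫ (block nα i′) (block mβ j′) (c₀′ (inj₂ (α , β , tt)))) ⟩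
      𝟙ᴮ α β i′ j′ - 𝟙ᴮ α β i′ j′
        ≈⟨ -‿inverseʳ _ ⟩
      0# ∎

    ε¹-coefficient-b₁ : ∀ x y z → ⟪ a₀ x , b₁ y , c₀ z ⟫ ≈ 0#
    ε¹-coefficient-b₁ (inj₂ _)    y         z        = ⟪0,_,_⟫ (b₁ y) (c₀ z)
    ε¹-coefficient-b₁ x@(inj₁ _)  (inj₁ _)  z        = ⟪_,0,_⟫ (a₀ x) (c₀ z)
    ε¹-coefficient-b₁ x@(inj₁ _)  y@(inj₂ _) (inj₁ _) = ⟪_,_,0⟫ (a₀ x) (b₁ y)
    ε¹-coefficient-b₁ (inj₁ i′) (inj₂ (α , β , t)) (inj₂ (α′ , β′ , _)) =
      trans (⟪𝟙,_,_⟫ i′ (V α β t) (𝟙ᴮ α′ β′)) (∑-V-𝟙ᴮ α β t i′ α′ β′)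

    ε¹-coefficient-a₁ : ∀ x y z → ⟪ a₁ x , b₀ y , c₀ z ⟫ ≈ 0#
    ε¹-coefficient-a₁ (inj₁ _)    y         z        = ⟪0,_,_⟫ (b₀ y) (c₀ z)
    ε¹-coefficient-a₁ x@(inj₂ _)  (inj₂ _)  z        = ⟪_,0,_⟫ (a₁ x) (c₀ z)
    ε¹-coefficient-a₁ x@(inj₂ _)  y@(inj₁ _) (inj₁ _) = ⟪_,_,0⟫ (a₁ x) (b₀ y)
    ε¹-coefficient-a₁ (inj₂ (α , β , t)) (inj₁ j′) (inj₂ (α′ , β′ , _)) =
      trans (⟪_,𝟙,_⟫ (U α β t) j′ (𝟙ᴮ α′ β′)) (∑-U-𝟙ᴮ α β t j′ α′ β′)

    ⟪U,V,𝟙ᴮ⟫-blockDiagonal : ∀ x y z → ⟪ a₁ (inj₂ x) , b₁ (inj₂ y) , c₀ (inj₂ z) ⟫ ≈ value blocks-presentation x y z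
    ⟪U,V,𝟙ᴮ⟫-blockDiagonal x y z = begin
      F x y z                              ≈⟨ blockDiagonal-unique p (value ∘ row) F diagonal offDiagonal x y z ⟩
      blockDiagonal p (value ∘ row) x y z  ≈⟨ ⨁-value p row x y z ⟨
      value blocks-presentation x y z     ∎
      where
      row : ∀ α → Presentation (⨁ K q λ β → MaMu K 1 (s α β) 1)
                    (Σ (Fin q) λ β → Fin (s α β)) (Σ (Fin q) λ β → Fin (s α β)) (Σ (Fin q) λ _ → ⊤)
      row α = ⨁-presentation q λ β → innerProduct-presentation (s α β)
      F : Blocks (λ α β → Fin (s α β)) → Blocks (λ α β → Fin (s α β)) → Blocks (λ _ _ → ⊤) → Carrier
      F x y z = ⟪ a₁ (inj₂ x) , b₁ (inj₂ y) , c₀ (inj₂ z) ⟫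
      diagonal : ∀ α x y z → F (α , x) (α , y) (α , z) ≈ value (row α) x y z
      diagonal α x y z = trans
        (blockDiagonal-unique q (λ β → value (innerProduct-presentation (s α β))) (λ x y z → F (α , x) (α , y) (α , z))
          (λ β t t′ _ → ⟪U,V,𝟙ᴮ⟫-diagonal α β t t′)
          (λ t t′ _ β-mismatch → ⟪U,V,𝟙ᴮ⟫-offDiagonal t t′ λ (_ , β≡β′ , _ , β≡β″) → β-mismatch (β≡β′ , β≡β″))
          x y z)
        (sym (⨁-value q _ x y z))
      offDiagonal : ∀ {α α′ α″} x y z → ¬ (α ≡ α′ × α ≡ α″) → F (α , x) (α′ , y) (α″ , z) ≈ 0#
      offDiagonal (_ , t) (_ , t′) _ α-mismatch =
        ⟪U,V,𝟙ᴮ⟫-offDiagonal t t′ λ (α≡α′ , _ , α≡α″ , _) → α-mismatch (α≡α′ , α≡α″)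

    ε²-coefficient : ∀ x y z → ⟪ a₀ x , b₀ y , c₂ z ⟫ + ⟪ a₁ x , b₁ y , c₀ z ⟫ ≈ value Target-presentation x y z
    ε²-coefficient (inj₁ i′) y@(inj₁ j′) z@(inj₁ _) = trans (+-cong (⟪𝟙,𝟙,_⟫ i′ j′ (c₂ z)) (⟪0,_,_⟫ (b₁ y) (c₀ z))) (+-identityʳ _)
    ε²-coefficient x@(inj₁ _) y@(inj₁ _) z@(inj₂ _) = +-≈0 (⟪_,_,0⟫ (a₀ x) (b₀ y)) (⟪0,_,_⟫ (b₁ y) (c₀ z))
    ε²-coefficient x@(inj₁ _) y@(inj₂ _) z          = +-≈0 (⟪_,0,_⟫ (a₀ x) (c₂ z)) (⟪0,_,_⟫ (b₁ y) (c₀ z))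
    ε²-coefficient x@(inj₂ _) y@(inj₁ _) z          = +-≈0 (⟪0,_,_⟫ (b₀ y) (c₂ z)) (⟪_,0,_⟫ (a₁ x) (c₀ z))
    ε²-coefficient x@(inj₂ _) y@(inj₂ _) z@(inj₁ _) = +-≈0 (⟪0,_,_⟫ (b₀ y) (c₂ z)) (⟪_,_,0⟫ (a₁ x) (b₁ y))
    ε²-coefficient (inj₂ x) y@(inj₂ y′) z@(inj₂ z′) =
      trans (+-cong (⟪0,_,_⟫ (b₀ y) (c₂ z)) (⟪U,V,𝟙ᴮ⟫-blockDiagonal x y′ z′)) (+-identityˡ _)

    decX : Fin (da Target) → TX
    decX = decodeX Target-presentation

    decY : Fin (db Target) → TY
    decY = decodeY Target-presentation

    decZ : Fin (dc Target) → TZ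
    decZ = decodeZ Target-presentation

    A₀ A₁ : Mat K (da Target) (da Source)
    A₀ u = rowX (a₀ (decX u)) (a₀′ (decX u))
    A₁ u = rowX (a₁ (decX u)) (λ _ → 0#)

    B₀ B₁ : Mat K (db Target) (db Source)
    B₀ v = rowY (b₀ (decY v)) (b₀′ (decY v))
    B₁ v = rowY (b₁ (decY v)) (λ _ → 0#)

    C₀ C₂ : Mat K (dc Target) (dc Source)
    C₀ w = rowZ (c₀ (decZ w)) (c₀′ (decZ w))
    C₂ w = rowZ (c₂ (decZ w)) (λ _ _ → 0#)

    act-ε⁰ : ∀ u v w → act K Source A₀ B₀ C₀ u v w ≈ 0#
    act-ε⁰ u v w = trans (act-rows (a₀ ∘ decX) (a₀′ ∘ decX) (b₀ ∘ decY) (b₀′ ∘ decY) (c₀ ∘ decZ) (c₀′ ∘ decZ) u v w)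
                         (ε⁰-coefficient (decX u) (decY v) (decZ w))

    act-ε¹ : ∀ u v w → act K Source A₀ B₁ C₀ u v w + act K Source A₁ B₀ C₀ u v w ≈ 0#
    act-ε¹ u v w = trans
      (+-cong (act-rows (a₀ ∘ decX) (a₀′ ∘ decX) (b₁ ∘ decY) (λ _ _ → 0#) (c₀ ∘ decZ) (c₀′ ∘ decZ) u v w)
              (act-rows (a₁ ∘ decX) (λ _ _ → 0#) (b₀ ∘ decY) (b₀′ ∘ decY) (c₀ ∘ decZ) (c₀′ ∘ decZ) u v w))
      (+-≈0 (+-≈0 (ε¹-coefficient-b₁ (decX u) (decY v) (decZ w)) (⟪_,0,_⟫ (λ α _ → a₀′ (decX u) α) (c₀′ (decZ w))))
            (+-≈0 (ε¹-coefficient-a₁ (decX u) (decY v) (decZ w)) (⟪0,_,_⟫ (λ _ β → b₀′ (decY v) β) (c₀′ (decZ w)))))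

    act-ε² : ∀ u v w → act K Source A₀ B₀ C₂ u v w + act K Source A₁ B₁ C₀ u v w ≈ entry Target u v w
    act-ε² u v w = begin
      act K Source A₀ B₀ C₂ u v w + act K Source A₁ B₁ C₀ u v w
        ≈⟨ +-cong (act-rows (a₀ ∘ decX) (a₀′ ∘ decX) (b₀ ∘ decY) (b₀′ ∘ decY) (c₂ ∘ decZ) (λ _ _ _ → 0#) u v w)
                  (act-rows (a₁ ∘ decX) (λ _ _ → 0#) (b₁ ∘ decY) (λ _ _ → 0#) (c₀ ∘ decZ) (c₀′ ∘ decZ) u v w) ⟩
      (⟪ a₀ x , b₀ y , c₂ z ⟫ + ⟪ (λ α _ → a₀′ x α) , (λ _ β → b₀′ y β) , (λ _ _ → 0#) ⟫) +
      (⟪ a₁ x , b₁ y , c₀ z ⟫ + ⟪ (λ _ _ → 0#) , (λ _ _ → 0#) , c₀′ z ⟫)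
        ≈⟨ +-cong (trans (+-congˡ (⟪_,_,0⟫ (λ α _ → a₀′ x α) (λ _ β → b₀′ y β))) (+-identityʳ _))
                  (trans (+-congˡ (⟪0,_,_⟫ (λ _ _ → 0#) (c₀′ z))) (+-identityʳ _)) ⟩
      ⟪ a₀ x , b₀ y , c₂ z ⟫ + ⟪ a₁ x , b₁ y , c₀ z ⟫
        ≈⟨ ε²-coefficient x y z ⟩
      value Target-presentation x y z
        ≈⟨ entry≈value Target-presentation u v w ⟨
      entry Target u v w ∎
      where
      x : TX
      x = decX u
      y : TY
      y = decY v
      z : TZ
      z = decZ w

    degeneration : _⊴_ K Target Source
    degeneration = quadratic-⊴ A₀ A₁ B₀ B₁ C₀ C₂ act-ε⁰ act-ε¹ act-ε²

open import Data.Nat using (_*_)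

theorem7p12 : {c ℓ : Level} (K : Field c ℓ) (p q : ℕ) → 1 ≤ p → 1 ≤ q →
    (nα : Fin p → ℕ) (mβ : Fin q → ℕ) →
    (∀ α → 1 ≤ nα α) → (∀ β → 1 ≤ mβ β) →
    _⊴_ K
      (_⊕_ K (MaMu K (sumℕ p nα) 1 (sumℕ q mβ))
        (⨁ K p (λ α → ⨁ K q (λ β → MaMu K 1 ((nα α ∸ 1) * (mβ β ∸ 1)) 1))))
      (_⊕_ K (unitT K (sumℕ p nα * sumℕ q mβ)) (MaMu K p 1 q))
theorem7p12 K p q _ _ nα mβ _ _ = Construction.degeneration K nα mβ
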